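{- Let $u$ and $v$ be $\mathbf c\mathbf d$-monomials of the same degree and $w$ be any $\mathbf c\mathbf d$-monomial. Then $\beta(u) > \beta(v)$ iff $\beta(u \cdot w) > \beta(v \cdot w)$, and $\beta(u) = \beta(v)$ iff $\beta(u \cdot w) = \beta(v \cdot w)$.
   Context: Let $\mathcal F = k\langle \mathbf c,\mathbf d\rangle$ ($k$ a field of characteristic 0, $\deg\mathbf c=1$, $\deg\mathbf d=2$) and $\hat{\mathcal F}=ke\oplus\mathcal F$ with $e$ a formal symbol of degree $-1$. Define $\Delta$ on $\mathcal F$ by $\Delta(1)=0$, $\Delta(\mathbf c)=2(1\otimes1)$, $\Delta(\mathbf d)=1\otimes\mathbf c+\mathbf c\otimes1$, $\Delta(uv)=\Delta(u)v+u\Delta(v)$, and $\hat\Delta(e)=e\otimes e$, $\hat\Delta(u)=\Delta(u)+e\otimes u+u\otimes e$. The product $\cdot$ on $\hat{\mathcal F}$ is the transpose of $\hat\Delta$ with respect to the monomial basis: the coefficient of $x$ in $u\cdot v$ equals the coefficient of $u\otimes v$ in $\hat\Delta(x)$. Explicitly, writing $\mathbf c^{m_1}\mathbf d\cdots\mathbf d\mathbf c^{m_k}$ as the list $(m_1,\dots,m_k)$, $(M',m)\cdot(n,N')=(M',m-1,n,N')+(M',m,n-1,N')+2(M',m+n+1,N')$ (lists with negative entries are zero), and $e$ is the unit. For a $\mathbf c\mathbf d$-monomial $v$ of degree $n$, $\beta(v)$ is the coefficient of $v$ in the $\mathbf c\mathbf d$-index $\Psi(B_{n+1})$ of the Boolean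 lattice of rank $n+1$; $\beta(e)=1$, extended linearly. -}

module Defs where

open import Data.Bool using (Bool; true; false; if_then_else_; _xor_)
open import Data.Nat using (ℕ; zero; suc; _+_)
open import Data.Nat.Combinatorics using (_C_)
open import Data.Integer as ℤ using (ℤ; +_; -_; _*_)
open import Data.List using (List; []; _∷_; _++_; map; foldr)
open import Data.Maybe using (Maybe; just; nothing)
open import Data.Product using (_×_; _,_)
open import Data.Vec using (Vec; toList)
import Data.Vec as Vec

-- cd-monomials (elements of the monomial basis of F = k<c,d>)
-- A cd-monomial c^{m1} d c^{m2} d ... d c^{mk} is stored as the word of
-- its letters; the empty word is the monomial 1.

data Letter : Set where
  𝐜 𝐝 : Letter

CDMono : Set
CDMono = List Letter

deg : CDMono → ℕ
deg []        = 0
deg (𝐜 ∷ v) = suc (deg v)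
deg (𝐝 ∷ v) = suc (suc (deg v))

cdMonos : ℕ → List CDMono
cdMonos zero          = [] ∷ []
cdMonos (suc zero)    = (𝐜 ∷ []) ∷ []
cdMonos (suc (suc n)) = map (𝐜 ∷_) (cdMonos (suc n)) ++ map (𝐝 ∷_) (cdMonos n)

-- The product on \hat F restricted to two cd-monomials, written out:
-- (M',m)·(n,N') = (M',m-1,n,N') + (M',m,n-1,N') + 2(M',m+n+1,N').

LinComb : Set
LinComb = List (ℕ × CDMono)

dropLastC : CDMono → Maybe CDMono
dropLastC []              = nothing
dropLastC (𝐜 ∷ [])      = just []
dropLastC (𝐝 ∷ [])      = nothing
dropLastC (x ∷ y ∷ r)   with dropLastC (y ∷ r)
... | just r' = just (x ∷ r')
... | nothing = nothing

termL : CDMono → CDMono → LinComb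
termL u w with dropLastC u
... | just u' = (1 , u' ++ 𝐝 ∷ w) ∷ []
... | nothing = []

termR : CDMono → CDMono → LinComb
termR u (𝐜 ∷ w') = (1 , u ++ 𝐝 ∷ w') ∷ []
termR u _         = []

_·_ : CDMono → CDMono → LinComb
u · w = termL u w ++ termR u w ++ ((2 , u ++ 𝐜 ∷ w) ∷ [])

-- ab-words of length n: Vec Bool n, with false = a and true = b.

allVecs : (n : ℕ) → List (Vec Bool n)
allVecs zero    = Vec.[] ∷ []
allVecs (suc n) = map (false Vec.∷_) (allVecs n) ++ map (true Vec.∷_) (allVecs n)

sumℤ : List ℤ → ℤ
sumℤ = foldr ℤ._+_ (+ 0)

-- coefficient of the ab-word x in the ab-expansion of the cd-monomial v
-- (c = a + b, d = ab + ba)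
abCoeff : CDMono → List Bool → ℤ
abCoeff []        []            = + 1
abCoeff (𝐜 ∷ v) (_ ∷ x)       = abCoeff v x
abCoeff (𝐝 ∷ v) (p ∷ q ∷ x)   = if p xor q then abCoeff v x else + 0
abCoeff _         _             = + 0

-- Flag f-vector of the Boolean lattice B_{n+1}.
-- S ⊆ {1,…,n} is given by its characteristic vector; ranks S lists its
-- elements in increasing order.
ranksFrom : ℕ → List Bool → List ℕ
ranksFrom k []           = []
ranksFrom k (true ∷ bs)  = k ∷ ranksFrom (suc k) bs
ranksFrom k (false ∷ bs) = ranksFrom (suc k) bs

-- number of chains x_1 < … < x_k < top in a Boolean lattice of rank top
-- with rank x_i = s_i (s_1 < … < s_k): C(s2,s1)·C(s3,s2)⋯C(top,sk)
chainCount : List ℕ → ℕ → ℕ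
chainCount []              top = 1
chainCount (s ∷ [])        top = top C s
chainCount (s ∷ t ∷ r)     top = (t C s) Data.Nat.* chainCount (t ∷ r) top

flagF : (n : ℕ) → Vec Bool n → ℕ
flagF n S = chainCount (ranksFrom 1 (toList S)) (suc n)

-- coefficient of the ab-word x in w_S = w_1⋯w_n, w_i = b if i ∈ S, a - b otherwise
wCoeff : List Bool → List Bool → ℤ
wCoeff []          []           = + 1
wCoeff (true ∷ S)  (true ∷ x)   = wCoeff S x
wCoeff (true ∷ S)  (false ∷ x)  = + 0
wCoeff (false ∷ S) (false ∷ x)  = wCoeff S x
wCoeff (false ∷ S) (true ∷ x)   = - wCoeff S x
wCoeff _           _            = + 0

-- coefficient of the ab-word x in the ab-index Ψ(B_{n+1}) = Σ_S f_S w_S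
abIndexB : (n : ℕ) → Vec Bool n → ℤ
abIndexB n x = sumℤ (map (λ S → + flagF n S * wCoeff (toList S) (toList x)) (allVecs n))

IsCdIndexB : (n : ℕ) → (CDMono → ℤ) → Set
IsCdIndexB n Φ = (x : Vec Bool n) →
  sumℤ (map (λ v → Φ v * abCoeff v (toList x)) (cdMonos n)) ≡ abIndexB n x
  where open import Relation.Binary.PropositionalEquality using (_≡_)

βlin : (CDMono → ℤ) → LinComb → ℤ
βlin Φ t = sumℤ (map (λ { (k , v) → + k * Φ v }) t)

-- Write β for the coefficients of the cd-index of a Boolean lattice.  For deg u = k and deg w = m the
-- coefficients of u · w in the cd-index of B_(k+m+2) factor as β(u · w) = β(u) · β(cᵏ · w): the product is
-- the transpose of the coproduct, which on ab-words cuts out one letter, and the flag numbers of B_(k+m+2)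
-- factor through a chain element of rank k + 1 as f(S₁ ∪ {k+1} ∪ S₂) = C(k+m+2, k+1) f(S₁) f(S₂).
-- Both comparisons therefore amount to multiplying by β(cᵏ · w), which is positive since every Boolean
-- lattice has a positive cd-index: B_(n+2) is the pyramid over B_(n+1), and the cd-pyramid operator carries
-- positive coefficients in degree n to positive coefficients in degree n + 1.
-- Identities between cd-coefficients are proved by comparing ab-expansions, which determine them.

module Submission where

module BooleanFlagVector where

  open import Data.Bool using (Bool; true; false)
  open import Data.List using (List; []; _∷_; _++_; length)
  open import Data.List.Properties using (length-++)
  open import Data.Nat
  open import Data.Nat.Combinatorics using (_C_; nCk+nC[k+1]≡[n+1]C[k+1]; nCn≡1; nCk≡nC[n∸k]; k>n⇒nCk≡0)
  open import Data.Nat.Properties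
  open import Data.Nat.Tactic.RingSolver using (solve-∀)
  open import Relation.Binary.PropositionalEquality
  open import Defs using (chainCount; ranksFrom)

  binom : ℕ → ℕ → ℕ
  binom n       zero    = 1
  binom zero    (suc k) = 0
  binom (suc n) (suc k) = binom n k + binom n (suc k)

  C≡binom : ∀ n k → n C k ≡ binom n k
  C≡binom n       zero    = trans (nCk≡nC[n∸k] {0} {n} z≤n) (nCn≡1 n)
  C≡binom zero    (suc k) = k>n⇒nCk≡0 {0} {suc k} (s≤s z≤n)
  C≡binom (suc n) (suc k) =
    trans (sym (nCk+nC[k+1]≡[n+1]C[k+1] n k)) (cong₂ _+_ (C≡binom n k) (C≡binom n (suc k)))

  binom[n,1+n+k]≡0 : ∀ n k → binom n (suc (n + k)) ≡ 0
  binom[n,1+n+k]≡0 zero    k = refl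
  binom[n,1+n+k]≡0 (suc n) k =
    cong₂ _+_ (binom[n,1+n+k]≡0 n k)
              (trans (cong (λ i → binom n (suc i)) (sym (+-suc n k))) (binom[n,1+n+k]≡0 n (suc k)))

  binom[n,n]≡1 : ∀ n → binom n n ≡ 1
  binom[n,n]≡1 zero    = refl
  binom[n,n]≡1 (suc n) =
    cong₂ _+_ (binom[n,n]≡1 n) (trans (cong (λ i → binom n (suc i)) (sym (+-identityʳ n))) (binom[n,1+n+k]≡0 n 0))

  binom[k+n,k]>0 : ∀ n k → binom (k + n) k > 0
  binom[k+n,k]>0 n zero    = s≤s z≤n
  binom[k+n,k]>0 n (suc k) = ≤-trans (binom[k+n,k]>0 n k) (m≤m+n _ _)

  binom*!*!≡! : ∀ a b → binom (a + b) a * (a ! * b !) ≡ (a + b) !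
  binom*!*!≡! zero    b = trans (*-identityˡ _) (*-identityˡ _)
  binom*!*!≡! (suc a) zero
    rewrite +-identityʳ a | binom[n,n]≡1 (suc a) = trans (+-identityʳ _) (*-identityʳ _)
  binom*!*!≡! (suc a) (suc b) = begin
      (binom (a + suc b) a + binom (a + suc b) (suc a)) * (suc a ! * suc b !)
    ≡⟨ cong (λ n → (binom (a + suc b) a + binom n (suc a)) * (suc a ! * suc b !)) (+-suc a b) ⟩
      (binom (a + suc b) a + binom (suc a + b) (suc a)) * (suc a ! * suc b !)
    ≡⟨ pascal-step (binom (a + suc b) a) (binom (suc a + b) (suc a)) (a !) (b !) a b ⟩
      suc a * (binom (a + suc b) a * (a ! * suc b !)) + suc b * (binom (suc a + b) (suc a) * (suc a ! * b !))
    ≡⟨ cong₂ (λ x y → suc a * x + suc b * y) (binom*!*!≡! a (suc b)) (binom*!*!≡! (suc a) b) ⟩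
      suc a * (a + suc b) ! + suc b * (suc a + b) !
    ≡⟨ cong (λ n → suc a * n ! + suc b * (suc a + b) !) (+-suc a b) ⟩
      suc a * (suc a + b) ! + suc b * (suc a + b) !
    ≡⟨ *-distribʳ-+ ((suc a + b) !) (suc a) (suc b) ⟨
      (suc a + suc b) * (suc a + b) !
    ≡⟨ cong (λ n → (suc a + suc b) * n !) (+-suc a b) ⟨
      (suc a + suc b) ! ∎
    where
    open ≡-Reasoning
    pascal-step : ∀ x y fa fb a b → (x + y) * (suc a * fa * (suc b * fb))
                ≡ suc a * (x * (fa * (suc b * fb))) + suc b * (y * (suc a * fa * fb))
    pascal-step = solve-∀

  binom-trinomial : ∀ a b e → binom (a + (b + e)) a * binom (b + e) b ≡ binom (a + b + e) (a + b) * binom (a + b) a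
  binom-trinomial a b e =
    *-cancelʳ-≡ _ _ (a ! * (b ! * e !)) {{factorials≢0}} (trans left (trans (cong _! (sym (+-assoc a b e))) (sym right)))
    where
    open ≡-Reasoning
    factorials≢0 : NonZero (a ! * (b ! * e !))
    factorials≢0 = m*n≢0 (a !) (b ! * e !) {{a !≢0}} {{m*n≢0 (b !) (e !) {{b !≢0}} {{e !≢0}}}}
    left : binom (a + (b + e)) a * binom (b + e) b * (a ! * (b ! * e !)) ≡ (a + (b + e)) !
    left = begin
        binom (a + (b + e)) a * binom (b + e) b * (a ! * (b ! * e !))
      ≡⟨ regroup (binom (a + (b + e)) a) (binom (b + e) b) (a !) (b !) (e !) ⟩
        binom (a + (b + e)) a * (a ! * (binom (b + e) b * (b ! * e !)))
      ≡⟨ cong (λ n → binom (a + (b + e)) a * (a ! * n)) (binom*!*!≡! b e) ⟩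
        binom (a + (b + e)) a * (a ! * (b + e) !)
      ≡⟨ binom*!*!≡! a (b + e) ⟩
        (a + (b + e)) ! ∎
      where
      regroup : ∀ x y fa fb fe → x * y * (fa * (fb * fe)) ≡ x * (fa * (y * (fb * fe)))
      regroup = solve-∀
    right : binom (a + b + e) (a + b) * binom (a + b) a * (a ! * (b ! * e !)) ≡ (a + b + e) !
    right = begin
        binom (a + b + e) (a + b) * binom (a + b) a * (a ! * (b ! * e !))
      ≡⟨ regroup (binom (a + b + e) (a + b)) (binom (a + b) a) (a !) (b !) (e !) ⟩
        binom (a + b + e) (a + b) * ((binom (a + b) a * (a ! * b !)) * e !)
      ≡⟨ cong (λ n → binom (a + b + e) (a + b) * (n * e !)) (binom*!*!≡! a b) ⟩
        binom (a + b + e) (a + b) * ((a + b) ! * e !)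
      ≡⟨ binom*!*!≡! (a + b) e ⟩
        (a + b + e) ! ∎
      where
      regroup : ∀ x y fa fb fe → x * y * (fa * (fb * fe)) ≡ x * ((y * (fa * fb)) * fe)
      regroup = solve-∀

  -- flagFrom j S is the flag number of B_(j + |S|) for the rank set {j + i | S has b at i}
  flagFrom : ℕ → List Bool → ℕ
  flagFrom j S = chainCount (ranksFrom j S) (j + length S)

  flag : List Bool → ℕ
  flag = flagFrom 1

  flagFrom-false : ∀ j S → flagFrom j (false ∷ S) ≡ flagFrom (suc j) S
  flagFrom-false j S = cong (chainCount (ranksFrom (suc j) S)) (+-suc j (length S))

  -- A chain with bottom rank j in B_T: choose the bottom element, then a chain of the upper interval B_(T ∸ j).
  chainCount-bottom : ∀ S j i r T → r ≡ j + i → T ≡ r + length S →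
                      chainCount (j ∷ ranksFrom r S) T ≡ binom T j * flagFrom i S
  chainCount-bottom []          j i r T r≡ T≡ = trans (C≡binom T j) (sym (*-identityʳ _))
  chainCount-bottom (false ∷ S) j i r T r≡ T≡ =
    trans (chainCount-bottom S j (suc i) (suc r) T (trans (cong suc r≡) (sym (+-suc j i))) (trans T≡ (+-suc r (length S))))
          (cong (binom T j *_) (sym (flagFrom-false i S)))
  chainCount-bottom (true ∷ S)  j i r T r≡ T≡ = begin
      (r C j) * chainCount (r ∷ ranksFrom (suc r) S) T
    ≡⟨ cong₂ _*_ (C≡binom r j) (chainCount-bottom S r 1 (suc r) T (+-comm 1 r) (trans T≡ (+-suc r (length S)))) ⟩
      binom r j * (binom T r * flag S)
    ≡⟨ cong (λ n → binom n j * (binom T n * flag S)) r≡ ⟩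
      binom (j + i) j * (binom T (j + i) * flag S)
    ≡⟨ swap (binom (j + i) j) (binom T (j + i)) (flag S) ⟩
      binom T (j + i) * binom (j + i) j * flag S
    ≡⟨ cong (λ n → binom n (j + i) * binom (j + i) j * flag S) T≡j+i+1+|S| ⟩
      binom (j + i + suc (length S)) (j + i) * binom (j + i) j * flag S
    ≡⟨ cong (_* flag S) (binom-trinomial j i (suc (length S))) ⟨
      binom (j + (i + suc (length S))) j * binom (i + suc (length S)) i * flag S
    ≡⟨ *-assoc (binom (j + (i + suc (length S))) j) _ _ ⟩
      binom (j + (i + suc (length S))) j * (binom (i + suc (length S)) i * flag S)
    ≡⟨ cong₂ (λ n m → binom n j * m) (trans T≡j+i+1+|S| (+-assoc j i _))
             (chainCount-bottom S i 1 (suc i) (i + suc (length S)) (+-comm 1 i) (+-suc i (length S))) ⟨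
      binom T j * flagFrom i (true ∷ S) ∎
    where
    open ≡-Reasoning
    T≡j+i+1+|S| : T ≡ j + i + suc (length S)
    T≡j+i+1+|S| = trans T≡ (cong (_+ suc (length S)) r≡)
    swap : ∀ x y z → x * (y * z) ≡ y * x * z
    swap = solve-∀

  flagFrom-true : ∀ j S → flagFrom j (true ∷ S) ≡ binom (j + suc (length S)) j * flag S
  flagFrom-true j S = chainCount-bottom S j 1 (suc j) (j + suc (length S)) (+-comm 1 j) (+-suc j (length S))

  flagFrom-++-true : ∀ S₁ S₂ j → flagFrom j (S₁ ++ true ∷ S₂)
                   ≡ binom (j + length S₁ + suc (length S₂)) (j + length S₁) * flagFrom j S₁ * flag S₂
  flagFrom-++-true []          S₂ j rewrite +-identityʳ j =
    trans (flagFrom-true j S₂) (cong (_* flag S₂) (sym (*-identityʳ (binom (j + suc (length S₂)) j))))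
  flagFrom-++-true (false ∷ S₁) S₂ j =
    trans (flagFrom-false j (S₁ ++ true ∷ S₂))
    (trans (flagFrom-++-true S₁ S₂ (suc j))
           (cong₂ (λ n m → binom (n + suc (length S₂)) n * m * flag S₂) (sym (+-suc j (length S₁))) (sym (flagFrom-false j S₁))))
  flagFrom-++-true (true ∷ S₁) S₂ j = begin
      flagFrom j (true ∷ (S₁ ++ true ∷ S₂))
    ≡⟨ flagFrom-true j (S₁ ++ true ∷ S₂) ⟩
      binom (j + suc (length (S₁ ++ true ∷ S₂))) j * flag (S₁ ++ true ∷ S₂)
    ≡⟨ cong₂ (λ n m → binom (j + suc n) j * m) (length-++ S₁) (flagFrom-++-true S₁ S₂ 1) ⟩
      binom (j + (l₁ + l₂)) j * (binom (l₁ + l₂) l₁ * flag S₁ * flag S₂)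
    ≡⟨ regroup (binom (j + (l₁ + l₂)) j) (binom (l₁ + l₂) l₁) (flag S₁) (flag S₂) ⟩
      binom (j + (l₁ + l₂)) j * binom (l₁ + l₂) l₁ * (flag S₁ * flag S₂)
    ≡⟨ cong (_* (flag S₁ * flag S₂)) (binom-trinomial j l₁ l₂) ⟩
      binom (j + l₁ + l₂) (j + l₁) * binom (j + l₁) j * (flag S₁ * flag S₂)
    ≡⟨ regroup′ (binom (j + l₁ + l₂) (j + l₁)) (binom (j + l₁) j) (flag S₁) (flag S₂) ⟩
      binom (j + l₁ + l₂) (j + l₁) * (binom (j + l₁) j * flag S₁) * flag S₂
    ≡⟨ cong (λ n → binom (j + l₁ + l₂) (j + l₁) * n * flag S₂) (flagFrom-true j S₁) ⟨
      binom (j + l₁ + l₂) (j + l₁) * flagFrom j (true ∷ S₁) * flag S₂ ∎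
    where
    open ≡-Reasoning
    l₁ l₂ : ℕ
    l₁ = suc (length S₁)
    l₂ = suc (length S₂)
    regroup : ∀ x y a b → x * (y * a * b) ≡ x * y * (a * b)
    regroup = solve-∀
    regroup′ : ∀ x y a b → x * y * (a * b) ≡ x * (y * a) * b
    regroup′ = solve-∀

open BooleanFlagVector

open import Data.Bool using (Bool; true; false; if_then_else_; not; _∧_; _xor_)
open import Data.Empty using (⊥-elim)
open import Data.Integer as ℤ using (ℤ; +_; _+_; _*_; -_; _≤_; _<_; +<+)
import Data.Integer.Properties as ℤₚ
open import Data.Integer.Tactic.RingSolver using (solve-∀)
open import Data.List using (List; []; _∷_; _++_; length; map; replicate; null)
import Data.List.Properties as Listₚ
open import Data.Maybe using (just; nothing; maybe′)
open import Data.Nat as ℕ using (ℕ; zero; suc; pred)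
import Data.Nat.Properties as ℕₚ
open import Data.Product using (_×_; _,_; proj₁; proj₂)
open import Data.Vec using (Vec; toList; fromList)
import Data.Vec as Vec
import Data.Vec.Properties as Vecₚ
open import Function.Bundles using (_⇔_; mk⇔)
open import Relation.Nullary using (yes; no)
open import Relation.Binary.PropositionalEquality
open import Defs

-- ab-words and recurrences for flag numbers

ABCoeffs : Set
ABCoeffs = List Bool → ℤ

CDCoeffs : Set
CDCoeffs = CDMono → ℤ

dropFirst : List Bool → List Bool
dropFirst []      = []
dropFirst (_ ∷ x) = x

dropLast : List Bool → List Bool
dropLast []          = []
dropLast (_ ∷ [])    = []
dropLast (p ∷ q ∷ x) = p ∷ dropLast (q ∷ x)

firstIsB : List Bool → Bool
firstIsB []      = false
firstIsB (p ∷ _) = p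

lastIsB : List Bool → Bool
lastIsB []          = false
lastIsB (p ∷ [])    = p
lastIsB (_ ∷ q ∷ x) = lastIsB (q ∷ x)

length-dropLast : ∀ p x → length (dropLast (p ∷ x)) ≡ length x
length-dropLast p []      = refl
length-dropLast p (q ∷ x) = cong suc (length-dropLast q x)

when : Bool → ℤ → ℤ
when true  z = z
when false z = + 0

when-0 : ∀ b → when b (+ 0) ≡ + 0
when-0 true  = refl
when-0 false = refl

when-+ : ∀ b y z → when b (y + z) ≡ when b y + when b z
when-+ true  y z = refl
when-+ false y z = refl

when-- : ∀ b y z → when b y + - when b z ≡ when b (y + - z)
when-- true  y z = refl
when-- false y z = refl

when-* : ∀ b k z → when b (k * z) ≡ k * when b z
when-* true  k z = refl
when-* false k z = sym (ℤₚ.*-zeroʳ k)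

when-not+when : ∀ b z → when (not b) z + when b z ≡ z
when-not+when true  z = ℤₚ.+-identityˡ z
when-not+when false z = ℤₚ.+-identityʳ z

-- Two recurrences for the flag numbers of Boolean lattices.  Under the ab-index transform they become
-- the two halves of the pyramid operator, whence 2 Ψ(B_(n+2)) = Pyr Ψ(B_(n+1)).

mergeL : ABCoeffs → ABCoeffs
mergeL F (p ∷ q ∷ y) = when p (F (true ∷ y)) + mergeL (λ z → F (p ∷ z)) (q ∷ y)
mergeL F _           = + 0

mergeR : ABCoeffs → ABCoeffs
mergeR F (p ∷ q ∷ y) = when q (F (true ∷ y)) + mergeR (λ z → F (p ∷ z)) (q ∷ y)
mergeR F _           = + 0

recL-rest : ABCoeffs → ABCoeffs
recL-rest F y = when (lastIsB y) (F (dropLast y)) + mergeL F y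

recL : ABCoeffs → ABCoeffs
recL F y = F (dropFirst y) + recL-rest F y

recR-rest : ABCoeffs → ABCoeffs
recR-rest F []          = + 0
recR-rest F (false ∷ y) = recR-rest (λ z → F (false ∷ z)) y
recR-rest F (true ∷ y)  = F (dropLast (true ∷ y)) + mergeR F (true ∷ y)

recR : ABCoeffs → ABCoeffs
recR F y = when (firstIsB y) (F (dropFirst y)) + F (dropLast y) + mergeR F y

mergeL-cong : ∀ {F G} → (∀ z → F z ≡ G z) → ∀ y → mergeL F y ≡ mergeL G y
mergeL-cong e []          = refl
mergeL-cong e (p ∷ [])    = refl
mergeL-cong e (p ∷ q ∷ y) = cong₂ _+_ (cong (when p) (e _)) (mergeL-cong (λ z → e (p ∷ z)) (q ∷ y))

mergeR-cong : ∀ {F G} → (∀ z → F z ≡ G z) → ∀ y → mergeR F y ≡ mergeR G y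
mergeR-cong e []          = refl
mergeR-cong e (p ∷ [])    = refl
mergeR-cong e (p ∷ q ∷ y) = cong₂ _+_ (cong (when q) (e _)) (mergeR-cong (λ z → e (p ∷ z)) (q ∷ y))

recL-rest-cong : ∀ {F G} → (∀ z → F z ≡ G z) → ∀ y → recL-rest F y ≡ recL-rest G y
recL-rest-cong e y = cong₂ _+_ (cong (when (lastIsB y)) (e _)) (mergeL-cong e y)

recR-rest-cong : ∀ {F G} → (∀ z → F z ≡ G z) → ∀ y → recR-rest F y ≡ recR-rest G y
recR-rest-cong e []          = refl
recR-rest-cong e (false ∷ y) = recR-rest-cong (λ z → e (false ∷ z)) y
recR-rest-cong e (true ∷ y)  = cong₂ _+_ (e _) (mergeR-cong e (true ∷ y))

mergeL-scale : ∀ (g : ℕ → ℤ) F y → mergeL (λ z → g (length z) * F z) y ≡ g (pred (length y)) * mergeL F y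
mergeL-scale g F []          = sym (ℤₚ.*-zeroʳ (g 0))
mergeL-scale g F (p ∷ [])    = sym (ℤₚ.*-zeroʳ (g 0))
mergeL-scale g F (p ∷ q ∷ y) =
  trans (cong₂ _+_ (when-* p (g (suc (length y))) (F (true ∷ y))) (mergeL-scale (λ n → g (suc n)) (λ z → F (p ∷ z)) (q ∷ y)))
        (sym (ℤₚ.*-distribˡ-+ (g (suc (length y))) _ _))

mergeR-scale : ∀ (g : ℕ → ℤ) F y → mergeR (λ z → g (length z) * F z) y ≡ g (pred (length y)) * mergeR F y
mergeR-scale g F []          = sym (ℤₚ.*-zeroʳ (g 0))
mergeR-scale g F (p ∷ [])    = sym (ℤₚ.*-zeroʳ (g 0))
mergeR-scale g F (p ∷ q ∷ y) =
  trans (cong₂ _+_ (when-* q (g (suc (length y))) (F (true ∷ y))) (mergeR-scale (λ n → g (suc n)) (λ z → F (p ∷ z)) (q ∷ y)))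
        (sym (ℤₚ.*-distribˡ-+ (g (suc (length y))) _ _))

recL-rest-false : ∀ F y → recL-rest F (false ∷ y) ≡ recL-rest (λ z → F (false ∷ z)) y
recL-rest-false F []      = refl
recL-rest-false F (q ∷ y) = cong (_+_ (when (lastIsB (q ∷ y)) (F (false ∷ dropLast (q ∷ y))))) (ℤₚ.+-identityˡ _)

recR≡dropFirst+recR-rest : ∀ F p y → recR F (p ∷ y) ≡ F y + recR-rest F (p ∷ y)
recR≡dropFirst+recR-rest F true  y = ℤₚ.+-assoc (F y) _ _
recR≡dropFirst+recR-rest F false [] = ring (F [])
  where
  ring : ∀ a → (+ 0 + a) + + 0 ≡ a + + 0
  ring = solve-∀
recR≡dropFirst+recR-rest F false (true ∷ y) =
  ring (F (false ∷ dropLast (true ∷ y))) (F (true ∷ y)) (mergeR (λ z → F (false ∷ z)) (true ∷ y))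
  where
  ring : ∀ a b c → (+ 0 + a) + (b + c) ≡ b + (a + c)
  ring = solve-∀
recR≡dropFirst+recR-rest F false (false ∷ y) =
  trans (cong (_+_ (+ 0 + F (false ∷ dropLast (false ∷ y)))) (ℤₚ.+-identityˡ _))
        (recR≡dropFirst+recR-rest (λ z → F (false ∷ z)) false y)

flagFromℤ : ℕ → ABCoeffs
flagFromℤ j S = + flagFrom j S

flagFromℤ-suc-true : ∀ j S → flagFromℤ (suc j) (true ∷ S) ≡ + binom (suc j ℕ.+ suc (length S)) (suc j) * flagFromℤ 1 S
flagFromℤ-suc-true j S = trans (cong +_ (flagFrom-true (suc j) S)) (ℤₚ.pos-* (binom (suc j ℕ.+ suc (length S)) (suc j)) (flag S))

flagFromℤ-pascal : ∀ j S → flagFromℤ (suc j) (true ∷ S)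
                 ≡ flagFromℤ j (true ∷ S) + + (binom (j ℕ.+ suc (length S)) (suc j) ℕ.* flag S)
flagFromℤ-pascal j S = begin
    flagFromℤ (suc j) (true ∷ S)
  ≡⟨ cong +_ (flagFrom-true (suc j) S) ⟩
    + ((binom n j ℕ.+ binom n (suc j)) ℕ.* flag S)
  ≡⟨ cong +_ (ℕₚ.*-distribʳ-+ (flag S) (binom n j) _) ⟩
    + (binom n j ℕ.* flag S ℕ.+ binom n (suc j) ℕ.* flag S)
  ≡⟨ ℤₚ.pos-+ (binom n j ℕ.* flag S) _ ⟩
    + (binom n j ℕ.* flag S) + + (binom n (suc j) ℕ.* flag S)
  ≡⟨ cong (_+ + (binom n (suc j) ℕ.* flag S)) (cong +_ (sym (flagFrom-true j S))) ⟩
    flagFromℤ j (true ∷ S) + + (binom n (suc j) ℕ.* flag S) ∎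
  where
  open ≡-Reasoning
  n : ℕ
  n = j ℕ.+ suc (length S)

binom[j+1,1+j]≡1 : ∀ j → binom (j ℕ.+ 1) (suc j) ≡ 1
binom[j+1,1+j]≡1 j = trans (cong (λ n → binom n (suc j)) (ℕₚ.+-comm j 1)) (binom[n,n]≡1 (suc j))

flagFrom0-∷ : ∀ p S → flagFrom 0 (p ∷ S) ≡ flag S
flagFrom0-∷ false S = flagFrom-false 0 S
flagFrom0-∷ true  S = trans (flagFrom-true 0 S) (ℕₚ.*-identityˡ (flag S))

mutual
  flagFromℤ-recL : ∀ S j → flagFromℤ (suc j) S ≡ flagFromℤ j S + recL-rest (flagFromℤ (suc j)) S
  flagFromℤ-recL []          j = refl
  flagFromℤ-recL (false ∷ S) j = begin
      flagFromℤ (suc j) (false ∷ S)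
    ≡⟨ cong +_ (flagFrom-false (suc j) S) ⟩
      flagFromℤ (suc (suc j)) S
    ≡⟨ flagFromℤ-recL S (suc j) ⟩
      flagFromℤ (suc j) S + recL-rest (flagFromℤ (suc (suc j))) S
    ≡⟨ cong₂ _+_ (cong +_ (sym (flagFrom-false j S))) (recL-rest-cong (λ z → cong +_ (sym (flagFrom-false (suc j) z))) S) ⟩
      flagFromℤ j (false ∷ S) + recL-rest (λ z → flagFromℤ (suc j) (false ∷ z)) S
    ≡⟨ cong (_+_ (flagFromℤ j (false ∷ S))) (recL-rest-false (flagFromℤ (suc j)) S) ⟨
      flagFromℤ j (false ∷ S) + recL-rest (flagFromℤ (suc j)) (false ∷ S) ∎
    where open ≡-Reasoning
  flagFromℤ-recL (true ∷ S)  j =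
    trans (flagFromℤ-pascal j S) (cong (_+_ (flagFromℤ j (true ∷ S))) (sym (recL-rest-true S j)))

  recL-rest-true : ∀ S j → recL-rest (flagFromℤ (suc j)) (true ∷ S) ≡ + (binom (j ℕ.+ suc (length S)) (suc j) ℕ.* flag S)
  recL-rest-true []      j = cong (λ n → + (n ℕ.* 1)) (sym (binom[j+1,1+j]≡1 j))
  recL-rest-true (q ∷ S) j = begin
      when (lastIsB (q ∷ S)) (flagFromℤ (suc j) (true ∷ dropLast (q ∷ S)))
        + (flagFromℤ (suc j) (true ∷ S) + mergeL (λ z → flagFromℤ (suc j) (true ∷ z)) (q ∷ S))
    ≡⟨ cong₂ (λ a b → when (lastIsB (q ∷ S)) a + (flagFromℤ (suc j) (true ∷ S) + b))
         (trans (flagFromℤ-suc-true j (dropLast (q ∷ S))) (cong (λ n → κ n * flagFromℤ 1 (dropLast (q ∷ S))) (length-dropLast q S)))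
         (trans (mergeL-cong (flagFromℤ-suc-true j) (q ∷ S)) (mergeL-scale κ (flagFromℤ 1) (q ∷ S))) ⟩
      when (lastIsB (q ∷ S)) (κ (length S) * flagFromℤ 1 (dropLast (q ∷ S)))
        + (flagFromℤ (suc j) (true ∷ S) + κ (length S) * mergeL (flagFromℤ 1) (q ∷ S))
    ≡⟨ cong₂ (λ a b → a + (b + κ (length S) * mergeL (flagFromℤ 1) (q ∷ S)))
         (when-* (lastIsB (q ∷ S)) (κ (length S)) _) (flagFromℤ-suc-true j S) ⟩
      κ (length S) * when (lastIsB (q ∷ S)) (flagFromℤ 1 (dropLast (q ∷ S)))
        + (κ (length S) * flagFromℤ 1 S + κ (length S) * mergeL (flagFromℤ 1) (q ∷ S))
    ≡⟨ factor (κ (length S)) _ _ _ ⟩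
      κ (length S) * recL (flagFromℤ 1) (q ∷ S)
    ≡⟨ cong (κ (length S) *_) (trans (flagFromℤ-recL (q ∷ S) 0) (cong (_+ recL-rest (flagFromℤ 1) (q ∷ S)) (cong +_ (flagFrom0-∷ q S)))) ⟨
      κ (length S) * flagFromℤ 1 (q ∷ S)
    ≡⟨ ℤₚ.pos-* (binom (suc j ℕ.+ suc (length S)) (suc j)) _ ⟨
      + (binom (suc j ℕ.+ suc (length S)) (suc j) ℕ.* flag (q ∷ S))
    ≡⟨ cong (λ n → + (binom n (suc j) ℕ.* flag (q ∷ S))) (ℕₚ.+-suc j (suc (length S))) ⟨
      + (binom (j ℕ.+ suc (length (q ∷ S))) (suc j) ℕ.* flag (q ∷ S)) ∎
    where
    open ≡-Reasoning
    κ : ℕ → ℤ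
    κ n = + binom (suc j ℕ.+ suc n) (suc j)
    factor : ∀ k a b c → k * a + (k * b + k * c) ≡ k * (b + (a + c))
    factor = solve-∀

flag-recL : ∀ p S → flagFromℤ 1 (p ∷ S) ≡ recL (flagFromℤ 1) (p ∷ S)
flag-recL p S = trans (flagFromℤ-recL (p ∷ S) 0) (cong (_+ recL-rest (flagFromℤ 1) (p ∷ S)) (cong +_ (flagFrom0-∷ p S)))

mutual
  flagFromℤ-recR : ∀ S j → flagFromℤ (suc j) S ≡ flagFromℤ j S + recR-rest (flagFromℤ (suc j)) S
  flagFromℤ-recR []          j = refl
  flagFromℤ-recR (false ∷ S) j = begin
      flagFromℤ (suc j) (false ∷ S)
    ≡⟨ cong +_ (flagFrom-false (suc j) S) ⟩
      flagFromℤ (suc (suc j)) S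
    ≡⟨ flagFromℤ-recR S (suc j) ⟩
      flagFromℤ (suc j) S + recR-rest (flagFromℤ (suc (suc j))) S
    ≡⟨ cong₂ _+_ (cong +_ (sym (flagFrom-false j S))) (recR-rest-cong (λ z → cong +_ (sym (flagFrom-false (suc j) z))) S) ⟩
      flagFromℤ j (false ∷ S) + recR-rest (flagFromℤ (suc j)) (false ∷ S) ∎
    where open ≡-Reasoning
  flagFromℤ-recR (true ∷ S)  j =
    trans (flagFromℤ-pascal j S) (cong (_+_ (flagFromℤ j (true ∷ S))) (sym (recR-rest-true S j)))

  recR-rest-true : ∀ S j → recR-rest (flagFromℤ (suc j)) (true ∷ S) ≡ + (binom (j ℕ.+ suc (length S)) (suc j) ℕ.* flag S)
  recR-rest-true []      j = cong (λ n → + (n ℕ.* 1)) (sym (binom[j+1,1+j]≡1 j))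
  recR-rest-true (q ∷ S) j = begin
      flagFromℤ (suc j) (true ∷ dropLast (q ∷ S))
        + (when q (flagFromℤ (suc j) (true ∷ S)) + mergeR (λ z → flagFromℤ (suc j) (true ∷ z)) (q ∷ S))
    ≡⟨ cong₂ (λ a b → a + (when q (flagFromℤ (suc j) (true ∷ S)) + b))
         (trans (flagFromℤ-suc-true j (dropLast (q ∷ S))) (cong (λ n → κ n * flagFromℤ 1 (dropLast (q ∷ S))) (length-dropLast q S)))
         (trans (mergeR-cong (flagFromℤ-suc-true j) (q ∷ S)) (mergeR-scale κ (flagFromℤ 1) (q ∷ S))) ⟩
      κ (length S) * flagFromℤ 1 (dropLast (q ∷ S))
        + (when q (flagFromℤ (suc j) (true ∷ S)) + κ (length S) * mergeR (flagFromℤ 1) (q ∷ S))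
    ≡⟨ cong (λ a → κ (length S) * flagFromℤ 1 (dropLast (q ∷ S)) + (a + κ (length S) * mergeR (flagFromℤ 1) (q ∷ S)))
         (trans (cong (when q) (flagFromℤ-suc-true j S)) (when-* q (κ (length S)) _)) ⟩
      κ (length S) * flagFromℤ 1 (dropLast (q ∷ S))
        + (κ (length S) * when q (flagFromℤ 1 S) + κ (length S) * mergeR (flagFromℤ 1) (q ∷ S))
    ≡⟨ factor (κ (length S)) _ _ _ ⟩
      κ (length S) * recR (flagFromℤ 1) (q ∷ S)
    ≡⟨ cong (κ (length S) *_) (trans (recR≡dropFirst+recR-rest (flagFromℤ 1) q S)
         (trans (cong (_+ recR-rest (flagFromℤ 1) (q ∷ S)) (cong +_ (sym (flagFrom0-∷ q S)))) (sym (flagFromℤ-recR (q ∷ S) 0)))) ⟩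
      κ (length S) * flagFromℤ 1 (q ∷ S)
    ≡⟨ ℤₚ.pos-* (binom (suc j ℕ.+ suc (length S)) (suc j)) _ ⟨
      + (binom (suc j ℕ.+ suc (length S)) (suc j) ℕ.* flag (q ∷ S))
    ≡⟨ cong (λ n → + (binom n (suc j) ℕ.* flag (q ∷ S))) (ℕₚ.+-suc j (suc (length S))) ⟨
      + (binom (j ℕ.+ suc (length (q ∷ S))) (suc j) ℕ.* flag (q ∷ S)) ∎
    where
    open ≡-Reasoning
    κ : ℕ → ℤ
    κ n = + binom (suc j ℕ.+ suc n) (suc j)
    factor : ∀ k a b c → k * a + (k * b + k * c) ≡ k * (b + a + c)
    factor = solve-∀

flag-recR : ∀ p S → flagFromℤ 1 (p ∷ S) ≡ recR (flagFromℤ 1) (p ∷ S)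
flag-recR p S =
  trans (flagFromℤ-recR (p ∷ S) 0)
  (trans (cong (_+ recR-rest (flagFromℤ 1) (p ∷ S)) (cong +_ (flagFrom0-∷ p S))) (sym (recR≡dropFirst+recR-rest (flagFromℤ 1) p S)))

-- The ab-index and the pyramid

-- abIndex F x is the coefficient of the ab-word x in Σ_S F(S) w_S (see wCoeff).
abIndex : ABCoeffs → ABCoeffs
abIndex F []          = F []
abIndex F (true ∷ x)  = abIndex (λ S → F (true ∷ S)) x + - abIndex (λ S → F (false ∷ S)) x
abIndex F (false ∷ x) = abIndex (λ S → F (false ∷ S)) x

abIndex-cong-length : ∀ {F G} x → (∀ S → length S ≡ length x → F S ≡ G S) → abIndex F x ≡ abIndex G x
abIndex-cong-length []          e = e [] refl
abIndex-cong-length (true ∷ x)  e =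
  cong₂ (λ a b → a + - b) (abIndex-cong-length x (λ S l → e (true ∷ S) (cong suc l)))
                          (abIndex-cong-length x (λ S l → e (false ∷ S) (cong suc l)))
abIndex-cong-length (false ∷ x) e = abIndex-cong-length x (λ S l → e (false ∷ S) (cong suc l))

abIndex-cong : ∀ {F G} x → (∀ S → F S ≡ G S) → abIndex F x ≡ abIndex G x
abIndex-cong x e = abIndex-cong-length x (λ S _ → e S)

abIndex-+ : ∀ F G x → abIndex (λ S → F S + G S) x ≡ abIndex F x + abIndex G x
abIndex-+ F G []          = refl
abIndex-+ F G (false ∷ x) = abIndex-+ (λ S → F (false ∷ S)) (λ S → G (false ∷ S)) x
abIndex-+ F G (true ∷ x)  =
  trans (cong₂ (λ a b → a + - b) (abIndex-+ (λ S → F (true ∷ S)) (λ S → G (true ∷ S)) x)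
                                 (abIndex-+ (λ S → F (false ∷ S)) (λ S → G (false ∷ S)) x))
        (ring (abIndex (λ S → F (true ∷ S)) x) (abIndex (λ S → G (true ∷ S)) x)
              (abIndex (λ S → F (false ∷ S)) x) (abIndex (λ S → G (false ∷ S)) x))
  where
  ring : ∀ a b c d → (a + b) + - (c + d) ≡ (a + - c) + (b + - d)
  ring = solve-∀

abIndex-* : ∀ k F x → abIndex (λ S → k * F S) x ≡ k * abIndex F x
abIndex-* k F []          = refl
abIndex-* k F (false ∷ x) = abIndex-* k (λ S → F (false ∷ S)) x
abIndex-* k F (true ∷ x)  =
  trans (cong₂ (λ a b → a + - b) (abIndex-* k (λ S → F (true ∷ S)) x) (abIndex-* k (λ S → F (false ∷ S)) x))
        (ring k (abIndex (λ S → F (true ∷ S)) x) (abIndex (λ S → F (false ∷ S)) x))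
  where
  ring : ∀ k a b → k * a + - (k * b) ≡ k * (a + - b)
  ring = solve-∀

abIndex-0 : ∀ x → abIndex (λ _ → + 0) x ≡ + 0
abIndex-0 []          = refl
abIndex-0 (false ∷ x) = abIndex-0 x
abIndex-0 (true ∷ x)  = cong₂ (λ a b → a + - b) (abIndex-0 x) (abIndex-0 x)

-- Summing over the letter at position |y| + 1 leaves exactly the sets containing that rank.
abIndex-split : ∀ F y z → abIndex F (y ++ false ∷ z) + abIndex F (y ++ true ∷ z)
              ≡ abIndex (λ S₁ → abIndex (λ S₂ → F (S₁ ++ true ∷ S₂)) z) y
abIndex-split F []          z = ring (abIndex (λ S → F (false ∷ S)) z) (abIndex (λ S → F (true ∷ S)) z)
  where
  ring : ∀ a b → a + (b + - a) ≡ b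
  ring = solve-∀
abIndex-split F (false ∷ y) z = abIndex-split (λ S → F (false ∷ S)) y z
abIndex-split F (true ∷ y)  z =
  trans (ring (abIndex (λ S → F (true ∷ S)) (y ++ false ∷ z)) (abIndex (λ S → F (false ∷ S)) (y ++ false ∷ z))
              (abIndex (λ S → F (true ∷ S)) (y ++ true ∷ z)) (abIndex (λ S → F (false ∷ S)) (y ++ true ∷ z)))
        (cong₂ (λ a b → a + - b) (abIndex-split (λ S → F (true ∷ S)) y z) (abIndex-split (λ S → F (false ∷ S)) y z))
  where
  ring : ∀ a b c d → (a + - b) + (c + - d) ≡ (a + c) + - (b + d)
  ring = solve-∀

-- The pyramid operator on ab-polynomials in coefficient form:
-- pyramidAB Ψ = c Ψ + Ψ c + Σ_(Ψ = u ℓ v) u D(ℓ) v with D(a) = D(b) = ab + ba.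

replaceBA : ABCoeffs → ABCoeffs
replaceBA G (p ∷ q ∷ x) = when (p ∧ not q) (G (false ∷ x) + G (true ∷ x)) + replaceBA (λ w → G (p ∷ w)) (q ∷ x)
replaceBA G _           = + 0

replaceAB : ABCoeffs → ABCoeffs
replaceAB G (p ∷ q ∷ x) = when (not p ∧ q) (G (false ∷ x) + G (true ∷ x)) + replaceAB (λ w → G (p ∷ w)) (q ∷ x)
replaceAB G _           = + 0

derivAB : ABCoeffs → ABCoeffs
derivAB G (p ∷ q ∷ x) = when (p xor q) (G (false ∷ x) + G (true ∷ x)) + derivAB (λ w → G (p ∷ w)) (q ∷ x)
derivAB G _           = + 0

abRecL : ABCoeffs → ABCoeffs
abRecL G x = when (not (firstIsB x)) (G (dropFirst x)) + when (lastIsB x) (G (dropLast x)) + replaceBA G x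

abRecR : ABCoeffs → ABCoeffs
abRecR G x = when (firstIsB x) (G (dropFirst x)) + when (not (lastIsB x)) (G (dropLast x)) + replaceAB G x

pyramidAB : ABCoeffs → ABCoeffs
pyramidAB G x = G (dropFirst x) + G (dropLast x) + derivAB G x

replaceBA-- : ∀ F G y → replaceBA (λ w → F w + - G w) y ≡ replaceBA F y + - replaceBA G y
replaceBA-- F G []          = refl
replaceBA-- F G (p ∷ [])    = refl
replaceBA-- F G (p ∷ q ∷ y) =
  trans (cong₂ _+_ (cong (when (p ∧ not q)) (ring (F (false ∷ y)) (F (true ∷ y)) (G (false ∷ y)) (G (true ∷ y))))
                   (replaceBA-- (λ w → F (p ∷ w)) (λ w → G (p ∷ w)) (q ∷ y)))
  (trans (cong (_+ (replaceBA (λ w → F (p ∷ w)) (q ∷ y) + - replaceBA (λ w → G (p ∷ w)) (q ∷ y)))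
               (sym (when-- (p ∧ not q) (F (false ∷ y) + F (true ∷ y)) (G (false ∷ y) + G (true ∷ y)))))
         (ring′ (when (p ∧ not q) (F (false ∷ y) + F (true ∷ y))) (when (p ∧ not q) (G (false ∷ y) + G (true ∷ y)))
                (replaceBA (λ w → F (p ∷ w)) (q ∷ y)) (replaceBA (λ w → G (p ∷ w)) (q ∷ y))))
  where
  ring : ∀ a b c d → (a + - c) + (b + - d) ≡ (a + b) + - (c + d)
  ring = solve-∀
  ring′ : ∀ a b c d → (a + - b) + (c + - d) ≡ (a + c) + - (b + d)
  ring′ = solve-∀

replaceAB-- : ∀ F G y → replaceAB (λ w → F w + - G w) y ≡ replaceAB F y + - replaceAB G y
replaceAB-- F G []          = refl
replaceAB-- F G (p ∷ [])    = refl
replaceAB-- F G (p ∷ q ∷ y) =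
  trans (cong₂ _+_ (cong (when (not p ∧ q)) (ring (F (false ∷ y)) (F (true ∷ y)) (G (false ∷ y)) (G (true ∷ y))))
                   (replaceAB-- (λ w → F (p ∷ w)) (λ w → G (p ∷ w)) (q ∷ y)))
  (trans (cong (_+ (replaceAB (λ w → F (p ∷ w)) (q ∷ y) + - replaceAB (λ w → G (p ∷ w)) (q ∷ y)))
               (sym (when-- (not p ∧ q) (F (false ∷ y) + F (true ∷ y)) (G (false ∷ y) + G (true ∷ y)))))
         (ring′ (when (not p ∧ q) (F (false ∷ y) + F (true ∷ y))) (when (not p ∧ q) (G (false ∷ y) + G (true ∷ y)))
                (replaceAB (λ w → F (p ∷ w)) (q ∷ y)) (replaceAB (λ w → G (p ∷ w)) (q ∷ y))))
  where
  ring : ∀ a b c d → (a + - c) + (b + - d) ≡ (a + b) + - (c + d)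
  ring = solve-∀
  ring′ : ∀ a b c d → (a + - b) + (c + - d) ≡ (a + c) + - (b + d)
  ring′ = solve-∀

abIndex-dropFirst : ∀ F p x → abIndex (λ y → F (dropFirst y)) (p ∷ x) ≡ when (not p) (abIndex F x)
abIndex-dropFirst F true  x = ℤₚ.+-inverseʳ (abIndex F x)
abIndex-dropFirst F false x = refl

abIndex-whenFirst : ∀ F p x → abIndex (λ y → when (firstIsB y) (F (dropFirst y))) (p ∷ x) ≡ when p (abIndex F x)
abIndex-whenFirst F true  x = trans (cong (λ a → abIndex F x + - a) (abIndex-0 x)) (ℤₚ.+-identityʳ (abIndex F x))
abIndex-whenFirst F false x = abIndex-0 x

abIndex-whenLast : ∀ F p x → abIndex (λ y → when (lastIsB y) (F (dropLast y))) (p ∷ x)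
                 ≡ when (lastIsB (p ∷ x)) (abIndex F (dropLast (p ∷ x)))
abIndex-whenLast F true  []      = ℤₚ.+-identityʳ (F [])
abIndex-whenLast F false []      = refl
abIndex-whenLast F false (q ∷ x) = trans (abIndex-cong-length (q ∷ x) (peel F false)) (abIndex-whenLast (λ S → F (false ∷ S)) q x)
  where
  peel : ∀ F s S → length S ≡ length (q ∷ x) → when (lastIsB (s ∷ S)) (F (dropLast (s ∷ S))) ≡ when (lastIsB S) (F (s ∷ dropLast S))
  peel F s (t ∷ S) _ = refl
abIndex-whenLast F true  (q ∷ x) =
  trans (cong₂ (λ a b → a + - b) (trans (abIndex-cong-length (q ∷ x) (peel F true)) (abIndex-whenLast (λ S → F (true ∷ S)) q x))
                                 (trans (abIndex-cong-length (q ∷ x) (peel F false)) (abIndex-whenLast (λ S → F (false ∷ S)) q x)))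
        (when-- (lastIsB (q ∷ x)) _ _)
  where
  peel : ∀ F s S → length S ≡ length (q ∷ x) → when (lastIsB (s ∷ S)) (F (dropLast (s ∷ S))) ≡ when (lastIsB S) (F (s ∷ dropLast S))
  peel F s (t ∷ S) _ = refl

abIndex-dropLast : ∀ F p x → abIndex (λ y → F (dropLast y)) (p ∷ x) ≡ when (not (lastIsB (p ∷ x))) (abIndex F (dropLast (p ∷ x)))
abIndex-dropLast F true  []      = ℤₚ.+-inverseʳ (F [])
abIndex-dropLast F false []      = refl
abIndex-dropLast F false (q ∷ x) = trans (abIndex-cong-length (q ∷ x) (peel F false)) (abIndex-dropLast (λ S → F (false ∷ S)) q x)
  where
  peel : ∀ F s S → length S ≡ length (q ∷ x) → F (dropLast (s ∷ S)) ≡ F (s ∷ dropLast S)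
  peel F s (t ∷ S) _ = refl
abIndex-dropLast F true  (q ∷ x) =
  trans (cong₂ (λ a b → a + - b) (trans (abIndex-cong-length (q ∷ x) (peel F true)) (abIndex-dropLast (λ S → F (true ∷ S)) q x))
                                 (trans (abIndex-cong-length (q ∷ x) (peel F false)) (abIndex-dropLast (λ S → F (false ∷ S)) q x)))
        (when-- (not (lastIsB (q ∷ x))) _ _)
  where
  peel : ∀ F s S → length S ≡ length (q ∷ x) → F (dropLast (s ∷ S)) ≡ F (s ∷ dropLast S)
  peel F s (t ∷ S) _ = refl

abIndex-mergeL : ∀ F x → abIndex (mergeL F) x ≡ replaceBA (abIndex F) x
abIndex-mergeL F []                    = refl
abIndex-mergeL F (true ∷ [])           = refl
abIndex-mergeL F (false ∷ [])          = refl
abIndex-mergeL F (false ∷ rest@(q ∷ x)) =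
  trans (abIndex-cong-length rest peel) (trans (abIndex-mergeL (λ S → F (false ∷ S)) rest) (sym (ℤₚ.+-identityˡ _)))
  where
  peel : ∀ S → length S ≡ length rest → mergeL F (false ∷ S) ≡ mergeL (λ z → F (false ∷ z)) S
  peel (t ∷ S) _ = ℤₚ.+-identityˡ _
abIndex-mergeL F (true ∷ rest@(q ∷ x)) = begin
    abIndex (λ y → mergeL F (true ∷ y)) rest + - abIndex (λ y → mergeL F (false ∷ y)) rest
  ≡⟨ cong₂ (λ a b → a + - b) (trans (abIndex-cong-length rest peelT) (abIndex-+ (λ y → F (true ∷ dropFirst y)) (mergeL Fb) rest))
                             (trans (abIndex-cong-length rest peelF) (abIndex-mergeL Fa rest)) ⟩
    (abIndex (λ y → Fb (dropFirst y)) rest + abIndex (mergeL Fb) rest) + - replaceBA (abIndex Fa) rest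
  ≡⟨ cong₂ (λ a b → (a + b) + - replaceBA (abIndex Fa) rest) (abIndex-dropFirst Fb q x) (abIndex-mergeL Fb rest) ⟩
    (when (not q) (abIndex Fb x) + replaceBA (abIndex Fb) rest) + - replaceBA (abIndex Fa) rest
  ≡⟨ ℤₚ.+-assoc (when (not q) (abIndex Fb x)) (replaceBA (abIndex Fb) rest) _ ⟩
    when (not q) (abIndex Fb x) + (replaceBA (abIndex Fb) rest + - replaceBA (abIndex Fa) rest)
  ≡⟨ cong₂ _+_ (cong (when (not q)) (sym (ring (abIndex Fa x) (abIndex Fb x)))) (sym (replaceBA-- (abIndex Fb) (abIndex Fa) rest)) ⟩
    replaceBA (abIndex F) (true ∷ rest) ∎
  where
  open ≡-Reasoning
  Fb Fa : ABCoeffs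
  Fb S = F (true ∷ S)
  Fa S = F (false ∷ S)
  peelT : ∀ S → length S ≡ length rest → mergeL F (true ∷ S) ≡ F (true ∷ dropFirst S) + mergeL Fb S
  peelT (t ∷ S) _ = refl
  peelF : ∀ S → length S ≡ length rest → mergeL F (false ∷ S) ≡ mergeL Fa S
  peelF (t ∷ S) _ = ℤₚ.+-identityˡ _
  ring : ∀ a b → a + (b + - a) ≡ b
  ring = solve-∀

abIndex-mergeR : ∀ F x → abIndex (mergeR F) x ≡ replaceAB (abIndex F) x
abIndex-mergeR F []                    = refl
abIndex-mergeR F (true ∷ [])           = refl
abIndex-mergeR F (false ∷ [])          = refl
abIndex-mergeR F (false ∷ rest@(q ∷ x)) = begin
    abIndex (λ y → mergeR F (false ∷ y)) rest
  ≡⟨ trans (abIndex-cong-length rest (peel false)) (abIndex-+ (λ y → when (firstIsB y) (F (true ∷ dropFirst y))) (mergeR Fa) rest) ⟩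
    abIndex (λ y → when (firstIsB y) (Fb (dropFirst y))) rest + abIndex (mergeR Fa) rest
  ≡⟨ cong₂ _+_ (abIndex-whenFirst Fb q x) (abIndex-mergeR Fa rest) ⟩
    when q (abIndex Fb x) + replaceAB (abIndex Fa) rest
  ≡⟨ cong (_+ replaceAB (abIndex Fa) rest) (cong (when q) (sym (ring (abIndex Fa x) (abIndex Fb x)))) ⟩
    replaceAB (abIndex F) (false ∷ rest) ∎
  where
  open ≡-Reasoning
  Fb Fa : ABCoeffs
  Fb S = F (true ∷ S)
  Fa S = F (false ∷ S)
  peel : ∀ s S → length S ≡ length rest → mergeR F (s ∷ S) ≡ when (firstIsB S) (F (true ∷ dropFirst S)) + mergeR (λ z → F (s ∷ z)) S
  peel s (t ∷ S) _ = refl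
  ring : ∀ a b → a + (b + - a) ≡ b
  ring = solve-∀
abIndex-mergeR F (true ∷ rest@(q ∷ x)) = begin
    abIndex (λ y → mergeR F (true ∷ y)) rest + - abIndex (λ y → mergeR F (false ∷ y)) rest
  ≡⟨ cong₂ (λ a b → a + - b) (trans (abIndex-cong-length rest (peel true)) (abIndex-+ first (mergeR Fb) rest))
                             (trans (abIndex-cong-length rest (peel false)) (abIndex-+ first (mergeR Fa) rest)) ⟩
    (abIndex first rest + abIndex (mergeR Fb) rest) + - (abIndex first rest + abIndex (mergeR Fa) rest)
  ≡⟨ cong₂ (λ a b → (abIndex first rest + a) + - (abIndex first rest + b)) (abIndex-mergeR Fb rest) (abIndex-mergeR Fa rest) ⟩
    (abIndex first rest + replaceAB (abIndex Fb) rest) + - (abIndex first rest + replaceAB (abIndex Fa) rest)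
  ≡⟨ ring (abIndex first rest) (replaceAB (abIndex Fb) rest) (replaceAB (abIndex Fa) rest) ⟩
    + 0 + (replaceAB (abIndex Fb) rest + - replaceAB (abIndex Fa) rest)
  ≡⟨ cong (_+_ (+ 0)) (sym (replaceAB-- (abIndex Fb) (abIndex Fa) rest)) ⟩
    replaceAB (abIndex F) (true ∷ rest) ∎
  where
  open ≡-Reasoning
  Fb Fa : ABCoeffs
  Fb S = F (true ∷ S)
  Fa S = F (false ∷ S)
  first : ABCoeffs
  first y = when (firstIsB y) (F (true ∷ dropFirst y))
  peel : ∀ s S → length S ≡ length rest → mergeR F (s ∷ S) ≡ first S + mergeR (λ z → F (s ∷ z)) S
  peel s (t ∷ S) _ = refl
  ring : ∀ a b c → (a + b) + - (a + c) ≡ + 0 + (b + - c)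
  ring = solve-∀

replaceBA+replaceAB : ∀ G x → replaceBA G x + replaceAB G x ≡ derivAB G x
replaceBA+replaceAB G []                = refl
replaceBA+replaceAB G (p ∷ [])          = refl
replaceBA+replaceAB G (p ∷ rest@(q ∷ x)) =
  trans (ring (when (p ∧ not q) s) (replaceBA (λ w → G (p ∷ w)) rest) (when (not p ∧ q) s) (replaceAB (λ w → G (p ∷ w)) rest))
        (cong₂ _+_ (ba+ab p q) (replaceBA+replaceAB (λ w → G (p ∷ w)) rest))
  where
  s : ℤ
  s = G (false ∷ x) + G (true ∷ x)
  ring : ∀ a b c d → (a + b) + (c + d) ≡ (a + c) + (b + d)
  ring = solve-∀
  ba+ab : ∀ p q → when (p ∧ not q) s + when (not p ∧ q) s ≡ when (p xor q) s
  ba+ab true  true  = refl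
  ba+ab true  false = ℤₚ.+-identityʳ s
  ba+ab false true  = ℤₚ.+-identityˡ s
  ba+ab false false = refl

abRecL+abRecR≡pyramidAB : ∀ G x → abRecL G x + abRecR G x ≡ pyramidAB G x
abRecL+abRecR≡pyramidAB G x =
  trans (ring (when (not f) A) (when l B) (replaceBA G x) (when f A) (when (not l) B) (replaceAB G x))
        (cong₂ _+_ (cong₂ _+_ (when-not+when f A) (trans (ℤₚ.+-comm (when l B) _) (when-not+when l B))) (replaceBA+replaceAB G x))
  where
  f l : Bool
  f = firstIsB x
  l = lastIsB x
  A B : ℤ
  A = G (dropFirst x)
  B = G (dropLast x)
  ring : ∀ a b c d e f → (a + b + c) + (d + e + f) ≡ ((a + d) + (b + e)) + (c + f)
  ring = solve-∀

abIndex-recL : ∀ F p x → abIndex (recL F) (p ∷ x) ≡ abRecL (abIndex F) (p ∷ x)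
abIndex-recL F p x = begin
    abIndex (recL F) (p ∷ x)
  ≡⟨ abIndex-+ (λ y → F (dropFirst y)) (recL-rest F) (p ∷ x) ⟩
    abIndex (λ y → F (dropFirst y)) (p ∷ x) + abIndex (recL-rest F) (p ∷ x)
  ≡⟨ cong (_+_ (abIndex (λ y → F (dropFirst y)) (p ∷ x))) (abIndex-+ (λ y → when (lastIsB y) (F (dropLast y))) (mergeL F) (p ∷ x)) ⟩
    abIndex (λ y → F (dropFirst y)) (p ∷ x)
      + (abIndex (λ y → when (lastIsB y) (F (dropLast y))) (p ∷ x) + abIndex (mergeL F) (p ∷ x))
  ≡⟨ cong₂ (λ a b → a + (b + abIndex (mergeL F) (p ∷ x))) (abIndex-dropFirst F p x) (abIndex-whenLast F p x) ⟩
    when (not p) (abIndex F x) + (when (lastIsB (p ∷ x)) (abIndex F (dropLast (p ∷ x))) + abIndex (mergeL F) (p ∷ x))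
  ≡⟨ cong (λ a → when (not p) (abIndex F x) + (when (lastIsB (p ∷ x)) (abIndex F (dropLast (p ∷ x))) + a)) (abIndex-mergeL F (p ∷ x)) ⟩
    when (not p) (abIndex F x) + (when (lastIsB (p ∷ x)) (abIndex F (dropLast (p ∷ x))) + replaceBA (abIndex F) (p ∷ x))
  ≡⟨ ℤₚ.+-assoc (when (not p) (abIndex F x)) _ _ ⟨
    abRecL (abIndex F) (p ∷ x) ∎
  where open ≡-Reasoning

abIndex-recR : ∀ F p x → abIndex (recR F) (p ∷ x) ≡ abRecR (abIndex F) (p ∷ x)
abIndex-recR F p x =
  trans (abIndex-+ (λ y → when (firstIsB y) (F (dropFirst y)) + F (dropLast y)) (mergeR F) (p ∷ x))
  (trans (cong (_+ abIndex (mergeR F) (p ∷ x)) (abIndex-+ (λ y → when (firstIsB y) (F (dropFirst y))) (λ y → F (dropLast y)) (p ∷ x)))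
         (cong₂ _+_ (cong₂ _+_ (abIndex-whenFirst F p x) (abIndex-dropLast F p x)) (abIndex-mergeR F (p ∷ x))))

-- B_(n+2) is the pyramid over B_(n+1).
abIndex-flag-pyramid : ∀ p x → + 2 * abIndex (flagFromℤ 1) (p ∷ x) ≡ pyramidAB (abIndex (flagFromℤ 1)) (p ∷ x)
abIndex-flag-pyramid p x = begin
    + 2 * abIndex (flagFromℤ 1) (p ∷ x)
  ≡⟨ twice (abIndex (flagFromℤ 1) (p ∷ x)) ⟩
    abIndex (flagFromℤ 1) (p ∷ x) + abIndex (flagFromℤ 1) (p ∷ x)
  ≡⟨ cong₂ _+_ (abIndex-cong-length (p ∷ x) viaL) (abIndex-cong-length (p ∷ x) viaR) ⟩
    abIndex (recL (flagFromℤ 1)) (p ∷ x) + abIndex (recR (flagFromℤ 1)) (p ∷ x)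
  ≡⟨ cong₂ _+_ (abIndex-recL (flagFromℤ 1) p x) (abIndex-recR (flagFromℤ 1) p x) ⟩
    abRecL (abIndex (flagFromℤ 1)) (p ∷ x) + abRecR (abIndex (flagFromℤ 1)) (p ∷ x)
  ≡⟨ abRecL+abRecR≡pyramidAB (abIndex (flagFromℤ 1)) (p ∷ x) ⟩
    pyramidAB (abIndex (flagFromℤ 1)) (p ∷ x) ∎
  where
  open ≡-Reasoning
  twice : ∀ a → + 2 * a ≡ a + a
  twice = solve-∀
  viaL : ∀ S → length S ≡ length (p ∷ x) → flagFromℤ 1 S ≡ recL (flagFromℤ 1) S
  viaL (s ∷ S) _ = flag-recL s S
  viaR : ∀ S → length S ≡ length (p ∷ x) → flagFromℤ 1 S ≡ recR (flagFromℤ 1) S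
  viaR (s ∷ S) _ = flag-recR s S

-- cd-polynomials and their ab-expansion

mutual
  -- cdToAB Φ x is the coefficient of the ab-word x in Σ_v Φ(v) v, where c = a + b and d = ab + ba.
  cdToAB : CDCoeffs → ABCoeffs
  cdToAB Φ []      = Φ []
  cdToAB Φ (p ∷ x) = cdToAB (λ v → Φ (𝐜 ∷ v)) x + dPart Φ p x

  dPart : CDCoeffs → Bool → List Bool → ℤ
  dPart Φ p []      = + 0
  dPart Φ p (q ∷ x) = when (p xor q) (cdToAB (λ v → Φ (𝐝 ∷ v)) x)

cdToAB-cong : ∀ {Φ Ψ} x → (∀ v → Φ v ≡ Ψ v) → cdToAB Φ x ≡ cdToAB Ψ x
cdToAB-cong []          e = e []
cdToAB-cong (p ∷ [])    e = cong (_+ + 0) (e _)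
cdToAB-cong (p ∷ q ∷ x) e =
  cong₂ _+_ (cdToAB-cong (q ∷ x) (λ v → e (𝐜 ∷ v))) (cong (when (p xor q)) (cdToAB-cong x (λ v → e (𝐝 ∷ v))))

cdToAB-cong-deg : ∀ {Φ Ψ} x → (∀ v → deg v ≡ length x → Φ v ≡ Ψ v) → cdToAB Φ x ≡ cdToAB Ψ x
cdToAB-cong-deg []          e = e [] refl
cdToAB-cong-deg (p ∷ [])    e = cong (_+ + 0) (e _ refl)
cdToAB-cong-deg (p ∷ q ∷ x) e =
  cong₂ _+_ (cdToAB-cong-deg (q ∷ x) (λ v l → e (𝐜 ∷ v) (cong suc l)))
            (cong (when (p xor q)) (cdToAB-cong-deg x (λ v l → e (𝐝 ∷ v) (cong (λ n → suc (suc n)) l))))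

cdToAB-0 : ∀ x → cdToAB (λ _ → + 0) x ≡ + 0
cdToAB-0 []          = refl
cdToAB-0 (p ∷ [])    = refl
cdToAB-0 (p ∷ q ∷ x) = trans (cong₂ _+_ (cdToAB-0 (q ∷ x)) (trans (cong (when (p xor q)) (cdToAB-0 x)) (when-0 (p xor q)))) refl

cdToAB-+ : ∀ Φ Ψ x → cdToAB (λ v → Φ v + Ψ v) x ≡ cdToAB Φ x + cdToAB Ψ x
cdToAB-+ Φ Ψ []          = refl
cdToAB-+ Φ Ψ (p ∷ [])    = ring (Φ (𝐜 ∷ [])) (Ψ (𝐜 ∷ []))
  where
  ring : ∀ a b → (a + b) + + 0 ≡ (a + + 0) + (b + + 0)
  ring = solve-∀
cdToAB-+ Φ Ψ (p ∷ q ∷ x) =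
  trans (cong₂ _+_ (cdToAB-+ (λ v → Φ (𝐜 ∷ v)) (λ v → Ψ (𝐜 ∷ v)) (q ∷ x))
                   (trans (cong (when (p xor q)) (cdToAB-+ (λ v → Φ (𝐝 ∷ v)) (λ v → Ψ (𝐝 ∷ v)) x)) (when-+ (p xor q) _ _)))
        (ring (cdToAB (λ v → Φ (𝐜 ∷ v)) (q ∷ x)) (cdToAB (λ v → Ψ (𝐜 ∷ v)) (q ∷ x))
              (when (p xor q) (cdToAB (λ v → Φ (𝐝 ∷ v)) x)) (when (p xor q) (cdToAB (λ v → Ψ (𝐝 ∷ v)) x)))
  where
  ring : ∀ a b c d → (a + b) + (c + d) ≡ (a + c) + (b + d)
  ring = solve-∀

cdToAB-* : ∀ k Φ x → cdToAB (λ v → k * Φ v) x ≡ k * cdToAB Φ x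
cdToAB-* k Φ []          = refl
cdToAB-* k Φ (p ∷ [])    = ring k (Φ (𝐜 ∷ []))
  where
  ring : ∀ k a → k * a + + 0 ≡ k * (a + + 0)
  ring = solve-∀
cdToAB-* k Φ (p ∷ q ∷ x) =
  trans (cong₂ _+_ (cdToAB-* k (λ v → Φ (𝐜 ∷ v)) (q ∷ x))
                   (trans (cong (when (p xor q)) (cdToAB-* k (λ v → Φ (𝐝 ∷ v)) x)) (when-* (p xor q) k _)))
        (sym (ℤₚ.*-distribˡ-+ k _ _))

cdToAB-- : ∀ Φ Ψ x → cdToAB (λ v → Φ v + - Ψ v) x ≡ cdToAB Φ x + - cdToAB Ψ x
cdToAB-- Φ Ψ x = trans (cdToAB-+ Φ (λ v → - Ψ v) x) (cong (_+_ (cdToAB Φ x)) negate)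
  where
  negate : cdToAB (λ v → - Ψ v) x ≡ - cdToAB Ψ x
  negate = trans (cdToAB-cong x (λ v → sym (ℤₚ.-1*i≡-i (Ψ v)))) (trans (cdToAB-* (ℤ.-[1+ 0 ]) Ψ x) (ℤₚ.-1*i≡-i _))

-- The ab-words ba·x and aa·x single out the d-part: the c-parts agree and only ba·x sees d.
cdToAB-d-vanish : ∀ Φ x → cdToAB Φ (true ∷ false ∷ x) ≡ + 0 → cdToAB Φ (false ∷ false ∷ x) ≡ + 0 →
                  cdToAB (λ v → Φ (𝐝 ∷ v)) x ≡ + 0
cdToAB-d-vanish Φ x ba≡0 aa≡0 = trans (ring C D) (cong₂ (λ a b → a + - b) ba≡0 aa≡0)
  where
  C D : ℤ
  C = cdToAB (λ v → Φ (𝐜 ∷ v)) (false ∷ x)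
  D = cdToAB (λ v → Φ (𝐝 ∷ v)) x
  ring : ∀ c d → d ≡ (c + d) + - (c + + 0)
  ring = solve-∀

cdToAB≡0⇒≡0 : ∀ v Φ → (∀ x → length x ≡ deg v → cdToAB Φ x ≡ + 0) → Φ v ≡ + 0
cdToAB≡0⇒≡0 []      Φ vanish = vanish [] refl
cdToAB≡0⇒≡0 (𝐝 ∷ v) Φ vanish = cdToAB≡0⇒≡0 v (λ w → Φ (𝐝 ∷ w)) λ x l →
  cdToAB-d-vanish Φ x (vanish (true ∷ false ∷ x) (cong (λ n → suc (suc n)) l)) (vanish (false ∷ false ∷ x) (cong (λ n → suc (suc n)) l))
cdToAB≡0⇒≡0 (𝐜 ∷ v) Φ vanish = cdToAB≡0⇒≡0 v (λ w → Φ (𝐜 ∷ w)) c-vanish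
  where
  dPart-vanish : ∀ x → length x ≡ deg v → dPart Φ false x ≡ + 0
  dPart-vanish []      l = refl
  dPart-vanish (q ∷ x) l =
    trans (cong (when q) (cdToAB-d-vanish Φ x (vanish (true ∷ false ∷ x) (cong suc l)) (vanish (false ∷ false ∷ x) (cong suc l))))
          (when-0 q)
  c-vanish : ∀ x → length x ≡ deg v → cdToAB (λ w → Φ (𝐜 ∷ w)) x ≡ + 0
  c-vanish x l =
    trans (sym (ℤₚ.+-identityʳ _))
          (trans (cong (_+_ (cdToAB (λ w → Φ (𝐜 ∷ w)) x)) (sym (dPart-vanish x l))) (vanish (false ∷ x) (cong suc l)))

cdToAB-injective : ∀ v {Φ Ψ} → (∀ x → length x ≡ deg v → cdToAB Φ x ≡ cdToAB Ψ x) → Φ v ≡ Ψ v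
cdToAB-injective v {Φ} {Ψ} agree = ℤₚ.i-j≡0⇒i≡j (Φ v) (Ψ v) (cdToAB≡0⇒≡0 v (λ w → Φ w + - Ψ w) λ x l →
  trans (cdToAB-- Φ Ψ x) (trans (cong (_+_ (cdToAB Φ x)) (cong -_ (sym (agree x l)))) (ℤₚ.+-inverseʳ (cdToAB Φ x))))

cdToAB-cᵏ : ∀ k Φ → cdToAB Φ (replicate k false) ≡ Φ (replicate k 𝐜)
cdToAB-cᵏ zero          Φ = refl
cdToAB-cᵏ (suc zero)    Φ = ℤₚ.+-identityʳ _
cdToAB-cᵏ (suc (suc k)) Φ = trans (ℤₚ.+-identityʳ _) (cdToAB-cᵏ (suc k) (λ v → Φ (𝐜 ∷ v)))

sumℤ-++ : ∀ xs ys → sumℤ (xs ++ ys) ≡ sumℤ xs + sumℤ ys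
sumℤ-++ []       ys = sym (ℤₚ.+-identityˡ _)
sumℤ-++ (x ∷ xs) ys = trans (cong (_+_ x) (sumℤ-++ xs ys)) (sym (ℤₚ.+-assoc x (sumℤ xs) (sumℤ ys)))

sumℤ-map-++ : ∀ {A : Set} (f : A → ℤ) xs ys → sumℤ (map f (xs ++ ys)) ≡ sumℤ (map f xs) + sumℤ (map f ys)
sumℤ-map-++ f xs ys = trans (cong sumℤ (Listₚ.map-++ f xs ys)) (sumℤ-++ (map f xs) (map f ys))

sumℤ-map-0 : ∀ {A : Set} (xs : List A) → sumℤ (map (λ _ → + 0) xs) ≡ + 0
sumℤ-map-0 []       = refl
sumℤ-map-0 (x ∷ xs) = trans (ℤₚ.+-identityˡ _) (sumℤ-map-0 xs)

sumℤ-map-neg : ∀ {A : Set} (f : A → ℤ) xs → sumℤ (map (λ a → - f a) xs) ≡ - sumℤ (map f xs)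
sumℤ-map-neg f []       = refl
sumℤ-map-neg f (x ∷ xs) = trans (cong (_+_ (- f x)) (sumℤ-map-neg f xs)) (sym (ℤₚ.neg-distrib-+ (f x) _))

sumℤ-map-*-if : ∀ {A : Set} b (f g : A → ℤ) xs
              → sumℤ (map (λ v → f v * (if b then g v else + 0)) xs) ≡ when b (sumℤ (map (λ v → f v * g v) xs))
sumℤ-map-*-if true  f g xs = refl
sumℤ-map-*-if false f g xs = trans (cong sumℤ (Listₚ.map-cong (λ v → ℤₚ.*-zeroʳ (f v)) xs)) (sumℤ-map-0 xs)

cdSum≡cdToAB : ∀ Φ x → sumℤ (map (λ v → Φ v * abCoeff v x) (cdMonos (length x))) ≡ cdToAB Φ x
cdSum≡cdToAB Φ []          = ring (Φ [])
  where
  ring : ∀ a → a * + 1 + + 0 ≡ a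
  ring = solve-∀
cdSum≡cdToAB Φ (p ∷ [])    = cong (_+ + 0) (ℤₚ.*-identityʳ (Φ (𝐜 ∷ [])))
cdSum≡cdToAB Φ (p ∷ q ∷ x) = begin
    sumℤ (map term (map (𝐜 ∷_) (cdMonos (suc (length x))) ++ map (𝐝 ∷_) (cdMonos (length x))))
  ≡⟨ sumℤ-map-++ term (map (𝐜 ∷_) (cdMonos (suc (length x)))) (map (𝐝 ∷_) (cdMonos (length x))) ⟩
    sumℤ (map term (map (𝐜 ∷_) (cdMonos (suc (length x))))) + sumℤ (map term (map (𝐝 ∷_) (cdMonos (length x))))
  ≡⟨ cong₂ _+_ (cong sumℤ (Listₚ.map-∘ (cdMonos (suc (length x))))) (cong sumℤ (Listₚ.map-∘ (cdMonos (length x)))) ⟨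
    sumℤ (map (λ v → Φ (𝐜 ∷ v) * abCoeff v (q ∷ x)) (cdMonos (suc (length x))))
      + sumℤ (map (λ v → Φ (𝐝 ∷ v) * (if p xor q then abCoeff v x else + 0)) (cdMonos (length x)))
  ≡⟨ cong₂ _+_ (cdSum≡cdToAB (λ v → Φ (𝐜 ∷ v)) (q ∷ x))
               (trans (sumℤ-map-*-if (p xor q) (λ v → Φ (𝐝 ∷ v)) (λ v → abCoeff v x) (cdMonos (length x)))
                      (cong (when (p xor q)) (cdSum≡cdToAB (λ v → Φ (𝐝 ∷ v)) x))) ⟩
    cdToAB Φ (p ∷ q ∷ x) ∎
  where
  open ≡-Reasoning
  term : CDMono → ℤ
  term v = Φ v * abCoeff v (p ∷ q ∷ x)

wSum≡abIndex : ∀ n F (x : Vec Bool n) → sumℤ (map (λ S → F (toList S) * wCoeff (toList S) (toList x)) (allVecs n)) ≡ abIndex F (toList x)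
wSum≡abIndex zero    F Vec.[]          = ring (F [])
  where
  ring : ∀ a → a * + 1 + + 0 ≡ a
  ring = solve-∀
wSum≡abIndex (suc n) F (true Vec.∷ x)  = begin
    sumℤ (map term (map (false Vec.∷_) (allVecs n) ++ map (true Vec.∷_) (allVecs n)))
  ≡⟨ sumℤ-map-++ term (map (false Vec.∷_) (allVecs n)) (map (true Vec.∷_) (allVecs n)) ⟩
    sumℤ (map term (map (false Vec.∷_) (allVecs n))) + sumℤ (map term (map (true Vec.∷_) (allVecs n)))
  ≡⟨ cong₂ _+_ (cong sumℤ (Listₚ.map-∘ (allVecs n))) (cong sumℤ (Listₚ.map-∘ (allVecs n))) ⟨
    sumℤ (map (λ S → F (false ∷ toList S) * - wCoeff (toList S) (toList x)) (allVecs n))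
      + sumℤ (map (λ S → F (true ∷ toList S) * wCoeff (toList S) (toList x)) (allVecs n))
  ≡⟨ cong (_+ sumℤ (map (λ S → F (true ∷ toList S) * wCoeff (toList S) (toList x)) (allVecs n)))
          (trans (cong sumℤ (Listₚ.map-cong (λ S → sym (ℤₚ.neg-distribʳ-* (F (false ∷ toList S)) (wCoeff (toList S) (toList x)))) (allVecs n)))
                 (sumℤ-map-neg (λ S → F (false ∷ toList S) * wCoeff (toList S) (toList x)) (allVecs n))) ⟩
    - sumℤ (map (λ S → F (false ∷ toList S) * wCoeff (toList S) (toList x)) (allVecs n))
      + sumℤ (map (λ S → F (true ∷ toList S) * wCoeff (toList S) (toList x)) (allVecs n))
  ≡⟨ cong₂ (λ a b → - a + b) (wSum≡abIndex n (λ S → F (false ∷ S)) x) (wSum≡abIndex n (λ S → F (true ∷ S)) x) ⟩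
    - abIndex (λ S → F (false ∷ S)) (toList x) + abIndex (λ S → F (true ∷ S)) (toList x)
  ≡⟨ ℤₚ.+-comm (- abIndex (λ S → F (false ∷ S)) (toList x)) _ ⟩
    abIndex F (true ∷ toList x) ∎
  where
  open ≡-Reasoning
  term : Vec Bool (suc n) → ℤ
  term S = F (toList S) * wCoeff (toList S) (true ∷ toList x)
wSum≡abIndex (suc n) F (false Vec.∷ x) = begin
    sumℤ (map term (map (false Vec.∷_) (allVecs n) ++ map (true Vec.∷_) (allVecs n)))
  ≡⟨ sumℤ-map-++ term (map (false Vec.∷_) (allVecs n)) (map (true Vec.∷_) (allVecs n)) ⟩
    sumℤ (map term (map (false Vec.∷_) (allVecs n))) + sumℤ (map term (map (true Vec.∷_) (allVecs n)))
  ≡⟨ cong₂ _+_ (cong sumℤ (Listₚ.map-∘ (allVecs n))) (cong sumℤ (Listₚ.map-∘ (allVecs n))) ⟨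
    sumℤ (map (λ S → F (false ∷ toList S) * wCoeff (toList S) (toList x)) (allVecs n))
      + sumℤ (map (λ S → F (true ∷ toList S) * + 0) (allVecs n))
  ≡⟨ cong₂ _+_ (wSum≡abIndex n (λ S → F (false ∷ S)) x)
               (trans (cong sumℤ (Listₚ.map-cong (λ S → ℤₚ.*-zeroʳ (F (true ∷ toList S))) (allVecs n))) (sumℤ-map-0 (allVecs n))) ⟩
    abIndex F (false ∷ toList x) + + 0
  ≡⟨ ℤₚ.+-identityʳ _ ⟩
    abIndex F (false ∷ toList x) ∎
  where
  open ≡-Reasoning
  term : Vec Bool (suc n) → ℤ
  term S = F (toList S) * wCoeff (toList S) (false ∷ toList x)

abIndexB≡abIndex-flag : ∀ n (x : Vec Bool n) → abIndexB n x ≡ abIndex (flagFromℤ 1) (toList x)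
abIndexB≡abIndex-flag n x =
  trans (cong sumℤ (Listₚ.map-cong (λ S → cong (λ m → + chainCount (ranksFrom 1 (toList S)) (suc m) * wCoeff (toList S) (toList x))
                                                (sym (Vecₚ.length-toList S))) (allVecs n)))
        (wSum≡abIndex n (flagFromℤ 1) x)

IsCdIndexB⇒cdToAB≡abIndex : ∀ n Φ → IsCdIndexB n Φ → ∀ x → length x ≡ n → cdToAB Φ x ≡ abIndex (flagFromℤ 1) x
IsCdIndexB⇒cdToAB≡abIndex .(length x) Φ isCd x refl = begin
    cdToAB Φ x
  ≡⟨ cdSum≡cdToAB Φ x ⟨
    sumℤ (map (λ v → Φ v * abCoeff v x) (cdMonos (length x)))
  ≡⟨ cong (λ y → sumℤ (map (λ v → Φ v * abCoeff v y) (cdMonos (length x)))) (Vecₚ.toList∘fromList x) ⟨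
    sumℤ (map (λ v → Φ v * abCoeff v (toList (fromList x))) (cdMonos (length x)))
  ≡⟨ isCd (fromList x) ⟩
    abIndexB (length x) (fromList x)
  ≡⟨ abIndexB≡abIndex-flag (length x) (fromList x) ⟩
    abIndex (flagFromℤ 1) (toList (fromList x))
  ≡⟨ cong (abIndex (flagFromℤ 1)) (Vecₚ.toList∘fromList x) ⟩
    abIndex (flagFromℤ 1) x ∎
  where open ≡-Reasoning

-- The product u · w

leftTerm : CDCoeffs → CDMono → CDMono → ℤ
leftTerm Φ u w = maybe′ (λ u′ → Φ (u′ ++ 𝐝 ∷ w)) (+ 0) (dropLastC u)

rightTerm : CDCoeffs → CDMono → CDMono → ℤ
rightTerm Φ u (𝐜 ∷ w) = Φ (u ++ 𝐝 ∷ w)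
rightTerm Φ u _       = + 0

prodCoeff : CDCoeffs → CDMono → CDMono → ℤ
prodCoeff Φ u w = leftTerm Φ u w + rightTerm Φ u w + + 2 * Φ (u ++ 𝐜 ∷ w)

βlin-++ : ∀ Φ xs ys → βlin Φ (xs ++ ys) ≡ βlin Φ xs + βlin Φ ys
βlin-++ Φ []       ys = sym (ℤₚ.+-identityˡ _)
βlin-++ Φ (t ∷ xs) ys =
  trans (cong (_+_ (+ proj₁ t * Φ (proj₂ t))) (βlin-++ Φ xs ys)) (sym (ℤₚ.+-assoc (+ proj₁ t * Φ (proj₂ t)) _ _))

βlin-· : ∀ Φ u w → βlin Φ (u · w) ≡ prodCoeff Φ u w
βlin-· Φ u w =
  trans (βlin-++ Φ (termL u w) _)
  (trans (cong (_+_ (βlin Φ (termL u w))) (βlin-++ Φ (termR u w) _))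
  (trans (cong₂ (λ a b → a + (b + (+ 2 * Φ (u ++ 𝐜 ∷ w) + + 0))) (βlin-termL u) (βlin-termR w))
         (ring (leftTerm Φ u w) (rightTerm Φ u w) (+ 2 * Φ (u ++ 𝐜 ∷ w)))))
  where
  ring : ∀ a b c → a + (b + (c + + 0)) ≡ a + b + c
  ring = solve-∀
  βlin-termL : ∀ u → βlin Φ (termL u w) ≡ leftTerm Φ u w
  βlin-termL u with dropLastC u
  ... | just u′ = trans (ℤₚ.+-identityʳ _) (ℤₚ.*-identityˡ _)
  ... | nothing = refl
  βlin-termR : ∀ w → βlin Φ (termR u w) ≡ rightTerm Φ u w
  βlin-termR []      = refl
  βlin-termR (𝐜 ∷ w) = trans (ℤₚ.+-identityʳ _) (ℤₚ.*-identityˡ _)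
  βlin-termR (𝐝 ∷ w) = refl

leftTerm-c∷ : ∀ Φ u w → leftTerm Φ (𝐜 ∷ u) w ≡ leftTerm (λ v → Φ (𝐜 ∷ v)) u w + when (null u) (Φ (𝐝 ∷ w))
leftTerm-c∷ Φ []      w = sym (ℤₚ.+-identityˡ _)
leftTerm-c∷ Φ (y ∷ r) w with dropLastC (y ∷ r)
... | just r′ = sym (ℤₚ.+-identityʳ _)
... | nothing = refl

leftTerm-d∷ : ∀ Φ u w → leftTerm Φ (𝐝 ∷ u) w ≡ leftTerm (λ v → Φ (𝐝 ∷ v)) u w
leftTerm-d∷ Φ []      w = refl
leftTerm-d∷ Φ (y ∷ r) w with dropLastC (y ∷ r)
... | just r′ = refl
... | nothing = refl

rightTerm-∷ : ∀ Φ ℓ u w → rightTerm Φ (ℓ ∷ u) w ≡ rightTerm (λ v → Φ (ℓ ∷ v)) u w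
rightTerm-∷ Φ ℓ u []      = refl
rightTerm-∷ Φ ℓ u (𝐜 ∷ w) = refl
rightTerm-∷ Φ ℓ u (𝐝 ∷ w) = refl

prodCoeff-c∷ : ∀ Φ u w → prodCoeff Φ (𝐜 ∷ u) w ≡ prodCoeff (λ v → Φ (𝐜 ∷ v)) u w + when (null u) (Φ (𝐝 ∷ w))
prodCoeff-c∷ Φ u w =
  trans (cong₂ (λ a b → a + b + + 2 * Φ (𝐜 ∷ (u ++ 𝐜 ∷ w))) (leftTerm-c∷ Φ u w) (rightTerm-∷ Φ 𝐜 u w))
        (ring (leftTerm (λ v → Φ (𝐜 ∷ v)) u w) (when (null u) (Φ (𝐝 ∷ w)))
              (rightTerm (λ v → Φ (𝐜 ∷ v)) u w) (+ 2 * Φ (𝐜 ∷ (u ++ 𝐜 ∷ w))))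
  where
  ring : ∀ a b c d → a + b + c + d ≡ a + c + d + b
  ring = solve-∀

prodCoeff-d∷ : ∀ Φ u w → prodCoeff Φ (𝐝 ∷ u) w ≡ prodCoeff (λ v → Φ (𝐝 ∷ v)) u w
prodCoeff-d∷ Φ u w = cong₂ (λ a b → a + b + + 2 * Φ (𝐝 ∷ (u ++ 𝐜 ∷ w))) (leftTerm-d∷ Φ u w) (rightTerm-∷ Φ 𝐝 u w)

cdToAB-when : ∀ b (Φ : CDCoeffs) z → cdToAB (λ w → when b (Φ w)) z ≡ when b (cdToAB Φ z)
cdToAB-when true  Φ z = refl
cdToAB-when false Φ z = cdToAB-0 z

cdToAB-when-null : ∀ K y → cdToAB (λ u → when (null u) K) y ≡ when (null y) K
cdToAB-when-null K []          = refl
cdToAB-when-null K (p ∷ [])    = refl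
cdToAB-when-null K (p ∷ q ∷ y) = cong₂ _+_ (cdToAB-0 (q ∷ y)) (trans (cong (when (p xor q)) (cdToAB-0 y)) (when-0 (p xor q)))

dPart-a+dPart-b : ∀ Φ p z → dPart Φ p (false ∷ z) + dPart Φ p (true ∷ z) ≡ cdToAB (λ v → Φ (𝐝 ∷ v)) z
dPart-a+dPart-b Φ true  z = ℤₚ.+-identityʳ _
dPart-a+dPart-b Φ false z = ℤₚ.+-identityˡ _

when-a-xor+when-b-xor : ∀ q z → when (false xor q) z + when (true xor q) z ≡ z
when-a-xor+when-b-xor true  z = ℤₚ.+-identityʳ z
when-a-xor+when-b-xor false z = ℤₚ.+-identityˡ z

cdToAB-rightTerm-[] : ∀ Φ z → cdToAB (rightTerm Φ []) z ≡ dPart Φ false z + dPart Φ true z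
cdToAB-rightTerm-[] Φ []          = refl
cdToAB-rightTerm-[] Φ (q ∷ [])    = trans (ℤₚ.+-identityʳ _) (sym (when-a-xor+when-b-xor q _))
cdToAB-rightTerm-[] Φ (q ∷ r ∷ z) =
  trans (cong (_+_ (cdToAB (λ v → Φ (𝐝 ∷ v)) (r ∷ z))) (trans (cong (when (q xor r)) (cdToAB-0 z)) (when-0 (q xor r))))
        (trans (ℤₚ.+-identityʳ _) (sym (when-a-xor+when-b-xor q _)))

prodCoeffAB : CDCoeffs → List Bool → CDMono → ℤ
prodCoeffAB Φ z u = cdToAB (prodCoeff Φ u) z

prodCoeffAB-c∷ : ∀ Φ z u → prodCoeffAB Φ z (𝐜 ∷ u)
               ≡ prodCoeffAB (λ v → Φ (𝐜 ∷ v)) z u + when (null u) (cdToAB (λ v → Φ (𝐝 ∷ v)) z)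
prodCoeffAB-c∷ Φ z u =
  trans (cdToAB-cong z (prodCoeff-c∷ Φ u))
  (trans (cdToAB-+ (prodCoeff (λ v → Φ (𝐜 ∷ v)) u) (λ w → when (null u) (Φ (𝐝 ∷ w))) z)
         (cong (_+_ (prodCoeffAB (λ v → Φ (𝐜 ∷ v)) z u)) (cdToAB-when (null u) (λ w → Φ (𝐝 ∷ w)) z)))

-- The product is the transpose of the coproduct, which on ab-words cuts out one letter.
cdToAB-prodCoeffAB : ∀ Φ y z → cdToAB (prodCoeffAB Φ z) y ≡ cdToAB Φ (y ++ false ∷ z) + cdToAB Φ (y ++ true ∷ z)
cdToAB-prodCoeffAB Φ []      z = begin
    cdToAB (prodCoeff Φ []) z
  ≡⟨ cdToAB-cong z (λ w → cong (_+ + 2 * Φ (𝐜 ∷ w)) (ℤₚ.+-identityˡ (rightTerm Φ [] w))) ⟩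
    cdToAB (λ w → rightTerm Φ [] w + + 2 * Φ (𝐜 ∷ w)) z
  ≡⟨ cdToAB-+ (rightTerm Φ []) (λ w → + 2 * Φ (𝐜 ∷ w)) z ⟩
    cdToAB (rightTerm Φ []) z + cdToAB (λ w → + 2 * Φ (𝐜 ∷ w)) z
  ≡⟨ cong₂ _+_ (cdToAB-rightTerm-[] Φ z) (cdToAB-* (+ 2) (λ w → Φ (𝐜 ∷ w)) z) ⟩
    (dPart Φ false z + dPart Φ true z) + + 2 * cdToAB (λ w → Φ (𝐜 ∷ w)) z
  ≡⟨ ring (dPart Φ false z) (dPart Φ true z) (cdToAB (λ w → Φ (𝐜 ∷ w)) z) ⟩
    cdToAB Φ (false ∷ z) + cdToAB Φ (true ∷ z) ∎
  where
  open ≡-Reasoning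
  ring : ∀ a b c → (a + b) + + 2 * c ≡ (c + a) + (c + b)
  ring = solve-∀
cdToAB-prodCoeffAB Φ (p ∷ y) z = begin
    cdToAB (λ u → prodCoeffAB Φ z (𝐜 ∷ u)) y + dPart (prodCoeffAB Φ z) p y
  ≡⟨ cong (_+ dPart (prodCoeffAB Φ z) p y)
       (trans (cdToAB-cong y (prodCoeffAB-c∷ Φ z))
       (trans (cdToAB-+ (prodCoeffAB Φc z) (λ u → when (null u) D) y) (cong₂ _+_ (cdToAB-prodCoeffAB Φc y z) (cdToAB-when-null D y)))) ⟩
    ((cdToAB Φc (y ++ false ∷ z) + cdToAB Φc (y ++ true ∷ z)) + when (null y) D) + dPart (prodCoeffAB Φ z) p y
  ≡⟨ split-d y ⟩
    cdToAB Φ (p ∷ y ++ false ∷ z) + cdToAB Φ (p ∷ y ++ true ∷ z) ∎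
  where
  open ≡-Reasoning
  Φc Φd : CDCoeffs
  Φc v = Φ (𝐜 ∷ v)
  Φd v = Φ (𝐝 ∷ v)
  D : ℤ
  D = cdToAB Φd z
  split-d : ∀ y → ((cdToAB Φc (y ++ false ∷ z) + cdToAB Φc (y ++ true ∷ z)) + when (null y) D) + dPart (prodCoeffAB Φ z) p y
              ≡ cdToAB Φ (p ∷ y ++ false ∷ z) + cdToAB Φ (p ∷ y ++ true ∷ z)
  split-d []       =
    trans (ℤₚ.+-identityʳ _) (trans (cong (_+_ (cdToAB Φc (false ∷ z) + cdToAB Φc (true ∷ z))) (sym (dPart-a+dPart-b Φ p z)))
          (ring (cdToAB Φc (false ∷ z)) (cdToAB Φc (true ∷ z)) (dPart Φ p (false ∷ z)) (dPart Φ p (true ∷ z))))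
    where
    ring : ∀ a b c d → (a + b) + (c + d) ≡ (a + c) + (b + d)
    ring = solve-∀
  split-d (q ∷ y′) =
    trans (cong (_+_ ((cdToAB Φc (q ∷ y′ ++ false ∷ z) + cdToAB Φc (q ∷ y′ ++ true ∷ z)) + + 0))
            (trans (cong (when (p xor q)) (trans (cdToAB-cong y′ (λ u → cdToAB-cong z (prodCoeff-d∷ Φ u))) (cdToAB-prodCoeffAB Φd y′ z)))
                   (when-+ (p xor q) _ _)))
          (ring (cdToAB Φc (q ∷ y′ ++ false ∷ z)) (cdToAB Φc (q ∷ y′ ++ true ∷ z))
                (when (p xor q) (cdToAB Φd (y′ ++ false ∷ z))) (when (p xor q) (cdToAB Φd (y′ ++ true ∷ z))))
    where
    ring : ∀ a b c d → ((a + b) + + 0) + (c + d) ≡ (a + c) + (b + d)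
    ring = solve-∀

-- Positivity of the cd-index of Boolean lattices

-- Coefficient form of the cd-pyramid Z ↦ c Z + Z c + D Z, where D is the derivation with D(c) = 2d, D(d) = cd + dc.

cTimes : CDCoeffs → CDCoeffs
cTimes Z (𝐜 ∷ v) = Z v
cTimes Z _       = + 0

timesC : CDCoeffs → CDCoeffs
timesC Z v = maybe′ Z (+ 0) (dropLastC v)

onlyD : CDCoeffs → CDCoeffs
onlyD Z (𝐝 ∷ v) = Z (𝐝 ∷ v)
onlyD Z _       = + 0

cToD : CDCoeffs → CDCoeffs
cToD Z (𝐜 ∷ v) = Z (𝐝 ∷ v)
cToD Z _       = + 0

derivCD : CDCoeffs → CDCoeffs
derivCD Z []      = + 0
derivCD Z (𝐜 ∷ v) = onlyD Z v + derivCD (λ w → Z (𝐜 ∷ w)) v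
derivCD Z (𝐝 ∷ v) = + 2 * Z (𝐜 ∷ v) + cToD Z v + derivCD (λ w → Z (𝐝 ∷ w)) v

pyramidCD : CDCoeffs → CDCoeffs
pyramidCD Z v = cTimes Z v + timesC Z v + derivCD Z v

derivAB-+ : ∀ F G y → derivAB (λ w → F w + G w) y ≡ derivAB F y + derivAB G y
derivAB-+ F G []          = refl
derivAB-+ F G (p ∷ [])    = refl
derivAB-+ F G (p ∷ q ∷ y) =
  trans (cong₂ _+_ (cong (when (p xor q)) (ring (F (false ∷ y)) (F (true ∷ y)) (G (false ∷ y)) (G (true ∷ y))))
                   (derivAB-+ (λ w → F (p ∷ w)) (λ w → G (p ∷ w)) (q ∷ y)))
  (trans (cong (_+ (derivAB (λ w → F (p ∷ w)) (q ∷ y) + derivAB (λ w → G (p ∷ w)) (q ∷ y)))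
               (when-+ (p xor q) (F (false ∷ y) + F (true ∷ y)) (G (false ∷ y) + G (true ∷ y))))
         (ring (when (p xor q) (F (false ∷ y) + F (true ∷ y))) (derivAB (λ w → F (p ∷ w)) (q ∷ y))
               (when (p xor q) (G (false ∷ y) + G (true ∷ y))) (derivAB (λ w → G (p ∷ w)) (q ∷ y))))
  where
  ring : ∀ a b c d → (a + c) + (b + d) ≡ (a + b) + (c + d)
  ring = solve-∀

derivAB-when : ∀ b F y → derivAB (λ w → when b (F w)) y ≡ when b (derivAB F y)
derivAB-when true  F y           = refl
derivAB-when false F []          = refl
derivAB-when false F (p ∷ [])    = refl
derivAB-when false F (p ∷ q ∷ y) = cong₂ _+_ (when-0 (p xor q)) (derivAB-when false (λ w → F (p ∷ w)) (q ∷ y))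

cdToAB-cTimes : ∀ Z p x → cdToAB (cTimes Z) (p ∷ x) ≡ cdToAB Z x
cdToAB-cTimes Z p []      = ℤₚ.+-identityʳ _
cdToAB-cTimes Z p (q ∷ x) =
  trans (cong (_+_ (cdToAB Z (q ∷ x))) (trans (cong (when (p xor q)) (cdToAB-0 x)) (when-0 (p xor q)))) (ℤₚ.+-identityʳ _)

timesC-c∷ : ∀ Z v → timesC Z (𝐜 ∷ v) ≡ timesC (λ w → Z (𝐜 ∷ w)) v + when (null v) (Z [])
timesC-c∷ Z []      = sym (ℤₚ.+-identityˡ _)
timesC-c∷ Z (y ∷ r) with dropLastC (y ∷ r)
... | just r′ = sym (ℤₚ.+-identityʳ _)
... | nothing = refl

timesC-d∷ : ∀ Z v → timesC Z (𝐝 ∷ v) ≡ timesC (λ w → Z (𝐝 ∷ w)) v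
timesC-d∷ Z []      = refl
timesC-d∷ Z (y ∷ r) with dropLastC (y ∷ r)
... | just r′ = refl
... | nothing = refl

cdToAB-timesC : ∀ Z p x → cdToAB (timesC Z) (p ∷ x) ≡ cdToAB Z (dropLast (p ∷ x))
cdToAB-timesC Z p []      = ℤₚ.+-identityʳ _
cdToAB-timesC Z p (q ∷ x) =
  cong₂ _+_ (trans (cdToAB-cong (q ∷ x) (timesC-c∷ Z))
            (trans (cdToAB-+ (timesC (λ w → Z (𝐜 ∷ w))) (λ v → when (null v) (Z [])) (q ∷ x))
            (trans (cong (_+_ (cdToAB (timesC (λ w → Z (𝐜 ∷ w))) (q ∷ x))) (cdToAB-when-null (Z []) (q ∷ x)))
            (trans (ℤₚ.+-identityʳ _) (cdToAB-timesC (λ w → Z (𝐜 ∷ w)) q x)))))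
            (trans (cong (when (p xor q)) (cdToAB-cong x (timesC-d∷ Z))) (sym (dPart-dropLast x)))
  where
  dPart-dropLast : ∀ x → dPart Z p (dropLast (q ∷ x)) ≡ when (p xor q) (cdToAB (timesC (λ w → Z (𝐝 ∷ w))) x)
  dPart-dropLast []      = sym (when-0 (p xor q))
  dPart-dropLast (r ∷ x) = cong (when (p xor q)) (sym (cdToAB-timesC (λ w → Z (𝐝 ∷ w)) r x))

cdToAB-onlyD : ∀ Z q x → cdToAB (onlyD Z) (q ∷ x) ≡ dPart Z q x
cdToAB-onlyD Z q []      = refl
cdToAB-onlyD Z q (r ∷ x) = trans (cong (_+ when (q xor r) (cdToAB (λ v → Z (𝐝 ∷ v)) x)) (cdToAB-0 (r ∷ x))) (ℤₚ.+-identityˡ _)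

cdToAB-cToD : ∀ Z x → dPart Z false x + dPart Z true x ≡ cdToAB (cToD Z) x
cdToAB-cToD Z []          = refl
cdToAB-cToD Z (r ∷ [])    = trans (when-a-xor+when-b-xor r _) (sym (ℤₚ.+-identityʳ _))
cdToAB-cToD Z (r ∷ s ∷ x) =
  trans (when-a-xor+when-b-xor r _)
        (sym (trans (cong (_+_ (cdToAB (λ v → Z (𝐝 ∷ v)) (s ∷ x))) (trans (cong (when (r xor s)) (cdToAB-0 x)) (when-0 (r xor s))))
                    (ℤₚ.+-identityʳ _)))

derivAB-dPart : ∀ Z p q x → derivAB (dPart Z p) (q ∷ x) ≡ dPart Z q x + when (p xor q) (derivAB (cdToAB (λ v → Z (𝐝 ∷ v))) x)
derivAB-dPart Z p q []      = sym (trans (ℤₚ.+-identityˡ _) (when-0 (p xor q)))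
derivAB-dPart Z p q (r ∷ x) =
  cong₂ _+_ (cong (when (q xor r)) (dPart-a+dPart-b Z p x)) (derivAB-when (p xor q) (cdToAB (λ v → Z (𝐝 ∷ v))) (r ∷ x))

cdToAB-derivCD : ∀ Z x → cdToAB (derivCD Z) x ≡ derivAB (cdToAB Z) x
cdToAB-derivCD Z []          = refl
cdToAB-derivCD Z (p ∷ [])    = refl
cdToAB-derivCD Z (p ∷ q ∷ x) = begin
    cdToAB (λ v → onlyD Z v + derivCD Zc v) (q ∷ x) + when (p xor q) (cdToAB (λ v → + 2 * Zc v + cToD Z v + derivCD Zd v) x)
  ≡⟨ cong₂ _+_ (trans (cdToAB-+ (onlyD Z) (derivCD Zc) (q ∷ x)) (cong₂ _+_ (cdToAB-onlyD Z q x) (cdToAB-derivCD Zc (q ∷ x))))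
               (cong (when (p xor q)) (trans (cdToAB-+ (λ v → + 2 * Zc v + cToD Z v) (derivCD Zd) x)
                  (cong₂ _+_ (trans (cdToAB-+ (λ v → + 2 * Zc v) (cToD Z) x) (cong (_+ cdToAB (cToD Z) x) (cdToAB-* (+ 2) Zc x)))
                             (cdToAB-derivCD Zd x)))) ⟩
    (dPart Z q x + derivAB (cdToAB Zc) (q ∷ x)) + when (p xor q) ((+ 2 * cdToAB Zc x + cdToAB (cToD Z) x) + derivAB (cdToAB Zd) x)
  ≡⟨ cong (_+_ (dPart Z q x + derivAB (cdToAB Zc) (q ∷ x))) (when-+ (p xor q) _ _) ⟩
    (dPart Z q x + derivAB (cdToAB Zc) (q ∷ x)) + (when (p xor q) (+ 2 * cdToAB Zc x + cdToAB (cToD Z) x) + when (p xor q) (derivAB (cdToAB Zd) x))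
  ≡⟨ ring (dPart Z q x) (derivAB (cdToAB Zc) (q ∷ x))
          (when (p xor q) (+ 2 * cdToAB Zc x + cdToAB (cToD Z) x)) (when (p xor q) (derivAB (cdToAB Zd) x)) ⟩
    when (p xor q) (+ 2 * cdToAB Zc x + cdToAB (cToD Z) x) + (derivAB (cdToAB Zc) (q ∷ x) + (dPart Z q x + when (p xor q) (derivAB (cdToAB Zd) x)))
  ≡⟨ cong₂ (λ a b → when (p xor q) a + (derivAB (cdToAB Zc) (q ∷ x) + b)) (sym cdToAB-a+b) (sym (derivAB-dPart Z p q x)) ⟩
    when (p xor q) (cdToAB Z (false ∷ x) + cdToAB Z (true ∷ x)) + (derivAB (cdToAB Zc) (q ∷ x) + derivAB (dPart Z p) (q ∷ x))
  ≡⟨ cong (_+_ (when (p xor q) (cdToAB Z (false ∷ x) + cdToAB Z (true ∷ x)))) (sym (derivAB-+ (cdToAB Zc) (dPart Z p) (q ∷ x))) ⟩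
    derivAB (cdToAB Z) (p ∷ q ∷ x) ∎
  where
  open ≡-Reasoning
  Zc Zd : CDCoeffs
  Zc w = Z (𝐜 ∷ w)
  Zd w = Z (𝐝 ∷ w)
  ring : ∀ a b c d → (a + b) + (c + d) ≡ c + (b + (a + d))
  ring = solve-∀
  cdToAB-a+b : cdToAB Z (false ∷ x) + cdToAB Z (true ∷ x) ≡ + 2 * cdToAB Zc x + cdToAB (cToD Z) x
  cdToAB-a+b = trans (ring′ (cdToAB Zc x) (dPart Z false x) (dPart Z true x)) (cong (_+_ (+ 2 * cdToAB Zc x)) (cdToAB-cToD Z x))
    where
    ring′ : ∀ a b c → (a + b) + (a + c) ≡ + 2 * a + (b + c)
    ring′ = solve-∀

cdToAB-pyramidCD : ∀ Z p x → cdToAB (pyramidCD Z) (p ∷ x) ≡ pyramidAB (cdToAB Z) (p ∷ x)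
cdToAB-pyramidCD Z p x =
  trans (cdToAB-+ (λ v → cTimes Z v + timesC Z v) (derivCD Z) (p ∷ x))
  (cong₂ _+_ (trans (cdToAB-+ (cTimes Z) (timesC Z) (p ∷ x)) (cong₂ _+_ (cdToAB-cTimes Z p x) (cdToAB-timesC Z p x)))
             (cdToAB-derivCD Z (p ∷ x)))

Nonneg : CDCoeffs → Set
Nonneg Z = ∀ v → + 0 ≤ Z v

onlyD-nonneg : ∀ {Z} → Nonneg Z → Nonneg (onlyD Z)
onlyD-nonneg Z≥0 []      = ℤₚ.≤-refl
onlyD-nonneg Z≥0 (𝐜 ∷ v) = ℤₚ.≤-refl
onlyD-nonneg Z≥0 (𝐝 ∷ v) = Z≥0 _

cToD-nonneg : ∀ {Z} → Nonneg Z → Nonneg (cToD Z)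
cToD-nonneg Z≥0 []      = ℤₚ.≤-refl
cToD-nonneg Z≥0 (𝐜 ∷ v) = Z≥0 _
cToD-nonneg Z≥0 (𝐝 ∷ v) = ℤₚ.≤-refl

cTimes-nonneg : ∀ {Z} → Nonneg Z → Nonneg (cTimes Z)
cTimes-nonneg Z≥0 []      = ℤₚ.≤-refl
cTimes-nonneg Z≥0 (𝐜 ∷ v) = Z≥0 v
cTimes-nonneg Z≥0 (𝐝 ∷ v) = ℤₚ.≤-refl

timesC-nonneg : ∀ {Z} → Nonneg Z → Nonneg (timesC Z)
timesC-nonneg {Z} Z≥0 v with dropLastC v
... | just u  = Z≥0 u
... | nothing = ℤₚ.≤-refl

derivCD-nonneg : ∀ {Z} → Nonneg Z → Nonneg (derivCD Z)
derivCD-nonneg Z≥0 []      = ℤₚ.≤-refl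
derivCD-nonneg Z≥0 (𝐜 ∷ v) = ℤₚ.+-mono-≤ (onlyD-nonneg Z≥0 v) (derivCD-nonneg (λ w → Z≥0 (𝐜 ∷ w)) v)
derivCD-nonneg Z≥0 (𝐝 ∷ v) =
  ℤₚ.+-mono-≤ (ℤₚ.+-mono-≤ (ℤₚ.*-monoˡ-≤-nonNeg (+ 2) (Z≥0 _)) (cToD-nonneg Z≥0 v)) (derivCD-nonneg (λ w → Z≥0 (𝐝 ∷ w)) v)

-- Every monomial of degree n + 1 arises from one of degree n by c· or by D (c ↦ 2d).
pyramidCD-positive : ∀ Z n → Nonneg Z → (∀ w → deg w ≡ n → + 0 < Z w) → ∀ v → deg v ≡ suc n → + 0 < pyramidCD Z v
pyramidCD-positive Z n Z≥0 Z>0 (𝐜 ∷ v) e =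
  ℤₚ.+-mono-<-≤ (ℤₚ.+-mono-<-≤ (Z>0 v (ℕₚ.suc-injective e)) (timesC-nonneg Z≥0 (𝐜 ∷ v))) (derivCD-nonneg Z≥0 (𝐜 ∷ v))
pyramidCD-positive Z n Z≥0 Z>0 (𝐝 ∷ v) e =
  ℤₚ.+-mono-≤-< (ℤₚ.+-mono-≤ (cTimes-nonneg Z≥0 (𝐝 ∷ v)) (timesC-nonneg Z≥0 (𝐝 ∷ v)))
    (ℤₚ.+-mono-<-≤ (ℤₚ.+-mono-<-≤ (ℤₚ.*-monoˡ-<-pos (+ 2) (Z>0 (𝐜 ∷ v) (ℕₚ.suc-injective e))) (cToD-nonneg Z≥0 v))
                   (derivCD-nonneg (λ w → Z≥0 (𝐝 ∷ w)) v))

-- Cutting Z down to degree n turns positivity in degree n into the global nonnegativity that pyramidCD-positive needs.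
restrictDeg : ℕ → CDCoeffs → CDCoeffs
restrictDeg n Z w with deg w ℕ.≟ n
... | yes _ = Z w
... | no  _ = + 0

restrictDeg-≡ : ∀ n Z w → deg w ≡ n → restrictDeg n Z w ≡ Z w
restrictDeg-≡ n Z w e with deg w ℕ.≟ n
... | yes _ = refl
... | no ne = ⊥-elim (ne e)

restrictDeg-nonneg : ∀ n Z → (∀ w → deg w ≡ n → + 0 < Z w) → Nonneg (restrictDeg n Z)
restrictDeg-nonneg n Z Z>0 w with deg w ℕ.≟ n
... | yes e = ℤₚ.<⇒≤ (Z>0 w e)
... | no  _ = ℤₚ.≤-refl

derivAB-cong-length : ∀ {F G} x → (∀ w → length w ≡ pred (length x) → F w ≡ G w) → derivAB F x ≡ derivAB G x
derivAB-cong-length []          e = refl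
derivAB-cong-length (p ∷ [])    e = refl
derivAB-cong-length (p ∷ q ∷ y) e =
  cong₂ _+_ (cong (when (p xor q)) (cong₂ _+_ (e _ refl) (e _ refl))) (derivAB-cong-length (q ∷ y) (λ w l → e (p ∷ w) (cong suc l)))

derivAB-* : ∀ k F y → derivAB (λ w → k * F w) y ≡ k * derivAB F y
derivAB-* k F []          = sym (ℤₚ.*-zeroʳ k)
derivAB-* k F (p ∷ [])    = sym (ℤₚ.*-zeroʳ k)
derivAB-* k F (p ∷ q ∷ y) =
  trans (cong₂ _+_ (trans (cong (when (p xor q)) (sym (ℤₚ.*-distribˡ-+ k (F (false ∷ y)) (F (true ∷ y))))) (when-* (p xor q) k _))
                   (derivAB-* k (λ w → F (p ∷ w)) (q ∷ y)))
        (sym (ℤₚ.*-distribˡ-+ k _ _))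

pyramidAB-cong-length : ∀ {F G} p x → (∀ w → length w ≡ length x → F w ≡ G w) → pyramidAB F (p ∷ x) ≡ pyramidAB G (p ∷ x)
pyramidAB-cong-length p x e = cong₂ _+_ (cong₂ _+_ (e x refl) (e _ (length-dropLast p x))) (derivAB-cong-length (p ∷ x) e)

pyramidAB-* : ∀ k F x → pyramidAB (λ w → k * F w) x ≡ k * pyramidAB F x
pyramidAB-* k F x =
  trans (cong (_+_ (k * F (dropFirst x) + k * F (dropLast x))) (derivAB-* k F x)) (ring k (F (dropFirst x)) (F (dropLast x)) (derivAB F x))
  where
  ring : ∀ k a b c → (k * a + k * b) + k * c ≡ k * (a + b + c)
  ring = solve-∀

IsScaledCdIndexB : ℕ → ℕ → CDCoeffs → Set
IsScaledCdIndexB n s Y = ∀ x → length x ≡ n → cdToAB Y x ≡ + s * abIndex (flagFromℤ 1) x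

scaledCdIndex-unique : ∀ {n s} Y Y′ → IsScaledCdIndexB n s Y → IsScaledCdIndexB n s Y′ → ∀ v → deg v ≡ n → Y v ≡ Y′ v
scaledCdIndex-unique Y Y′ isY isY′ v e = cdToAB-injective v (λ x l → trans (isY x (trans l e)) (sym (isY′ x (trans l e))))

scaledCdIndex-* : ∀ {n s} k Y → IsScaledCdIndexB n s Y → IsScaledCdIndexB n (k ℕ.* s) (λ v → + k * Y v)
scaledCdIndex-* {s = s} k Y isY x l =
  trans (cdToAB-* (+ k) _ x) (trans (cong (+ k *_) (isY x l)) (trans (sym (ℤₚ.*-assoc (+ k) (+ s) _)) (cong (_* _) (sym (ℤₚ.pos-* k s)))))

scaledCdIndex-pyramid : ∀ {n s} Z → IsScaledCdIndexB n s Z → IsScaledCdIndexB (suc n) (2 ℕ.* s) (pyramidCD (restrictDeg n Z))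
scaledCdIndex-pyramid {n} {s} Z isZ (p ∷ x) l = begin
    cdToAB (pyramidCD (restrictDeg n Z)) (p ∷ x)
  ≡⟨ cdToAB-pyramidCD (restrictDeg n Z) p x ⟩
    pyramidAB (cdToAB (restrictDeg n Z)) (p ∷ x)
  ≡⟨ pyramidAB-cong-length p x restricted ⟩
    pyramidAB (λ w → + s * abIndex (flagFromℤ 1) w) (p ∷ x)
  ≡⟨ pyramidAB-* (+ s) (abIndex (flagFromℤ 1)) (p ∷ x) ⟩
    + s * pyramidAB (abIndex (flagFromℤ 1)) (p ∷ x)
  ≡⟨ cong (+ s *_) (abIndex-flag-pyramid p x) ⟨
    + s * (+ 2 * abIndex (flagFromℤ 1) (p ∷ x))
  ≡⟨ ring (+ s) (abIndex (flagFromℤ 1) (p ∷ x)) ⟩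
    + 2 * + s * abIndex (flagFromℤ 1) (p ∷ x)
  ≡⟨ cong (_* abIndex (flagFromℤ 1) (p ∷ x)) (ℤₚ.pos-* 2 s) ⟨
    + (2 ℕ.* s) * abIndex (flagFromℤ 1) (p ∷ x) ∎
  where
  open ≡-Reasoning
  |x|≡n : length x ≡ n
  |x|≡n = ℕₚ.suc-injective l
  restricted : ∀ w → length w ≡ length x → cdToAB (restrictDeg n Z) w ≡ + s * abIndex (flagFromℤ 1) w
  restricted w lw =
    trans (cdToAB-cong-deg w (λ u du → restrictDeg-≡ n Z u (trans du (trans lw |x|≡n)))) (isZ w (trans lw |x|≡n))
  ring : ∀ a b → a * (+ 2 * b) ≡ + 2 * a * b
  ring = solve-∀

-- The coefficients of 1 · w: splitting off the bottom rank of B_(n+2) leaves B_(n+1), chosen in n + 2 ways.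
scaledCdIndex-1· : ∀ {n s} Y → IsScaledCdIndexB (suc n) s Y → IsScaledCdIndexB n (s ℕ.* binom (suc (suc n)) 1) (prodCoeff Y [])
scaledCdIndex-1· {n} {s} Y isY z l = begin
    cdToAB (prodCoeffAB Y z) []
  ≡⟨ cdToAB-prodCoeffAB Y [] z ⟩
    cdToAB Y (false ∷ z) + cdToAB Y (true ∷ z)
  ≡⟨ cong₂ _+_ (isY (false ∷ z) (cong suc l)) (isY (true ∷ z) (cong suc l)) ⟩
    + s * abIndex (flagFromℤ 1) (false ∷ z) + + s * abIndex (flagFromℤ 1) (true ∷ z)
  ≡⟨ ℤₚ.*-distribˡ-+ (+ s) _ _ ⟨
    + s * (abIndex (flagFromℤ 1) (false ∷ z) + abIndex (flagFromℤ 1) (true ∷ z))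
  ≡⟨ cong (+ s *_) (abIndex-split (flagFromℤ 1) [] z) ⟩
    + s * abIndex (λ S → flagFromℤ 1 (true ∷ S)) z
  ≡⟨ cong (+ s *_) (trans (abIndex-cong-length z bottom) (abIndex-* (+ binom (suc (suc n)) 1) (flagFromℤ 1) z)) ⟩
    + s * (+ binom (suc (suc n)) 1 * abIndex (flagFromℤ 1) z)
  ≡⟨ ℤₚ.*-assoc (+ s) _ _ ⟨
    + s * + binom (suc (suc n)) 1 * abIndex (flagFromℤ 1) z
  ≡⟨ cong (_* abIndex (flagFromℤ 1) z) (ℤₚ.pos-* s _) ⟨
    + (s ℕ.* binom (suc (suc n)) 1) * abIndex (flagFromℤ 1) z ∎
  where
  open ≡-Reasoning
  bottom : ∀ S → length S ≡ length z → flagFromℤ 1 (true ∷ S) ≡ + binom (suc (suc n)) 1 * flagFromℤ 1 S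
  bottom S l′ = trans (cong +_ (flagFrom-true 1 S))
                      (trans (ℤₚ.pos-* (binom (suc (suc (length S))) 1) (flag S))
                             (cong (λ t → + binom (suc (suc t)) 1 * flagFromℤ 1 S) (trans l′ l)))

-- The cd-index of a Boolean lattice is positive: 1 · (-) lowers the degree, and the pyramid raises it back.
scaledCdIndex-positive : ∀ n s Y → 0 ℕ.< s → IsScaledCdIndexB n s Y → ∀ v → deg v ≡ n → + 0 < Y v
scaledCdIndex-positive zero    s Y s>0 isY (𝐜 ∷ v) ()
scaledCdIndex-positive zero    s Y s>0 isY (𝐝 ∷ v) ()
scaledCdIndex-positive zero    s Y s>0 isY []      _ = subst (+ 0 <_) (sym (trans (isY [] refl) (ℤₚ.*-identityʳ (+ s)))) (+<+ s>0)
scaledCdIndex-positive (suc n) s Y s>0 isY v e =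
  ℤₚ.*-cancelˡ-<-nonNeg K (subst (_< K * Y v) (sym (ℤₚ.*-zeroʳ K)) (subst (+ 0 <_) P≡KY (P>0)))
  where
  c : ℕ
  c = binom (suc (suc n)) 1
  K : ℤ
  K = + (2 ℕ.* c)
  Z : CDCoeffs
  Z = prodCoeff Y []
  isZ : IsScaledCdIndexB n (s ℕ.* c) Z
  isZ = scaledCdIndex-1· {n} {s} Y isY
  Z>0 : ∀ w → deg w ≡ n → + 0 < Z w
  Z>0 = scaledCdIndex-positive n (s ℕ.* c) Z (ℕₚ.*-mono-< s>0 (binom[k+n,k]>0 (suc n) 1)) isZ
  P≡KY : pyramidCD (restrictDeg n Z) v ≡ K * Y v
  P≡KY = scaledCdIndex-unique {suc n} {2 ℕ.* c ℕ.* s} (pyramidCD (restrictDeg n Z)) (λ w → K * Y w)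
           (subst (λ t → IsScaledCdIndexB (suc n) t (pyramidCD (restrictDeg n Z))) (reassoc s c) (scaledCdIndex-pyramid {n} {s ℕ.* c} Z isZ))
           (scaledCdIndex-* {suc n} {s} (2 ℕ.* c) Y isY) v e
    where
    reassoc : ∀ s c → 2 ℕ.* (s ℕ.* c) ≡ 2 ℕ.* c ℕ.* s
    reassoc s c = trans (cong (2 ℕ.*_) (ℕₚ.*-comm s c)) (sym (ℕₚ.*-assoc 2 c s))
  P>0 : + 0 < pyramidCD (restrictDeg n Z) v
  P>0 = pyramidCD-positive (restrictDeg n Z) n (restrictDeg-nonneg n Z Z>0)
          (λ w ew → subst (+ 0 <_) (sym (restrictDeg-≡ n Z w ew)) (Z>0 w ew)) v e

-- Factorisation of β(u · w)

abIndex-aᵏ : ∀ k F → abIndex F (replicate k false) ≡ F (replicate k false)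
abIndex-aᵏ zero    F = refl
abIndex-aᵏ (suc k) F = abIndex-aᵏ k (λ S → F (false ∷ S))

flagFrom-∅ : ∀ k j → flagFrom j (replicate k false) ≡ 1
flagFrom-∅ k j = cong (λ R → chainCount R (j ℕ.+ length (replicate k false))) (ranks-∅ k j)
  where
  ranks-∅ : ∀ k j → ranksFrom j (replicate k false) ≡ []
  ranks-∅ zero    j = refl
  ranks-∅ (suc k) j = ranks-∅ k (suc j)

deg-cᵏ : ∀ k → deg (replicate k 𝐜) ≡ k
deg-cᵏ zero    = refl
deg-cᵏ (suc k) = cong suc (deg-cᵏ k)

flag-++-true : ∀ S₁ S₂ → flagFromℤ 1 (S₁ ++ true ∷ S₂)
             ≡ + binom (suc (length S₁) ℕ.+ suc (length S₂)) (suc (length S₁)) * flagFromℤ 1 S₁ * flagFromℤ 1 S₂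
flag-++-true S₁ S₂ =
  trans (cong +_ (flagFrom-++-true S₁ S₂ 1))
        (trans (ℤₚ.pos-* (binom (suc (length S₁) ℕ.+ suc (length S₂)) (suc (length S₁)) ℕ.* flag S₁) (flag S₂))
               (cong (_* flagFromℤ 1 S₂) (ℤₚ.pos-* (binom (suc (length S₁) ℕ.+ suc (length S₂)) (suc (length S₁))) (flag S₁))))

module BooleanProduct (k m : ℕ) (Φ Φ′ : CDCoeffs) (isCd : IsCdIndexB k Φ) (isCd′ : IsCdIndexB (k ℕ.+ m ℕ.+ 1) Φ′) where

  cᵏ : CDMono
  cᵏ = replicate k 𝐜

  cb : ℕ
  cb = binom (suc k ℕ.+ suc m) (suc k)

  rightFactor : List Bool → ℤ
  rightFactor z = + cb * abIndex (flagFromℤ 1) z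

  cdIndex : ∀ x → length x ≡ k → cdToAB Φ x ≡ abIndex (flagFromℤ 1) x
  cdIndex = IsCdIndexB⇒cdToAB≡abIndex k Φ isCd

  cdIndex′ : ∀ x → length x ≡ k ℕ.+ m ℕ.+ 1 → cdToAB Φ′ x ≡ abIndex (flagFromℤ 1) x
  cdIndex′ = IsCdIndexB⇒cdToAB≡abIndex (k ℕ.+ m ℕ.+ 1) Φ′ isCd′

  length-++-∷ : ∀ y (s : Bool) z → length y ≡ k → length z ≡ m → length (y ++ s ∷ z) ≡ k ℕ.+ m ℕ.+ 1
  length-++-∷ y s z |y|≡k |z|≡m =
    trans (Listₚ.length-++ y) (trans (cong₂ (λ a b → a ℕ.+ suc b) |y|≡k |z|≡m) (trans (ℕₚ.+-suc k m) (ℕₚ.+-comm 1 (k ℕ.+ m))))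

  -- Ψ(B_(k+m+2)) restricted to the sets containing k + 1 is C(k+m+2, k+1) Ψ(B_(k+1)) ⊗ Ψ(B_(m+1)).
  cdToAB-prodCoeffAB≡abIndex⊗abIndex : ∀ y z → length y ≡ k → length z ≡ m →
      cdToAB (prodCoeffAB Φ′ z) y ≡ rightFactor z * abIndex (flagFromℤ 1) y
  cdToAB-prodCoeffAB≡abIndex⊗abIndex y z |y|≡k |z|≡m = begin
      cdToAB (prodCoeffAB Φ′ z) y
    ≡⟨ cdToAB-prodCoeffAB Φ′ y z ⟩
      cdToAB Φ′ (y ++ false ∷ z) + cdToAB Φ′ (y ++ true ∷ z)
    ≡⟨ cong₂ _+_ (cdIndex′ (y ++ false ∷ z) (length-++-∷ y false z |y|≡k |z|≡m))
                 (cdIndex′ (y ++ true ∷ z) (length-++-∷ y true z |y|≡k |z|≡m)) ⟩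
      abIndex F (y ++ false ∷ z) + abIndex F (y ++ true ∷ z)
    ≡⟨ abIndex-split F y z ⟩
      abIndex (λ S₁ → abIndex (λ S₂ → F (S₁ ++ true ∷ S₂)) z) y
    ≡⟨ abIndex-cong-length y (λ S₁ l₁ → trans (abIndex-cong-length z (λ S₂ l₂ → product S₁ S₂ (trans l₁ |y|≡k) (trans l₂ |z|≡m)))
                                               (abIndex-* (+ cb * F S₁) F z)) ⟩
      abIndex (λ S₁ → + cb * F S₁ * abIndex F z) y
    ≡⟨ abIndex-cong y (λ S₁ → swap (+ cb) (F S₁) (abIndex F z)) ⟩
      abIndex (λ S₁ → rightFactor z * F S₁) y
    ≡⟨ abIndex-* (rightFactor z) F y ⟩
      rightFactor z * abIndex F y ∎
    where
    open ≡-Reasoning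
    F : ABCoeffs
    F = flagFromℤ 1
    product : ∀ S₁ S₂ → length S₁ ≡ k → length S₂ ≡ m → F (S₁ ++ true ∷ S₂) ≡ (+ cb * F S₁) * F S₂
    product S₁ S₂ l₁ l₂ =
      trans (flag-++-true S₁ S₂) (cong (λ t → + t * F S₁ * F S₂) (cong₂ (λ a b → binom (suc a ℕ.+ suc b) (suc a)) l₁ l₂))
    swap : ∀ a b c → a * b * c ≡ a * c * b
    swap = solve-∀

  prodCoeffAB-factorises : ∀ u z → deg u ≡ k → length z ≡ m → prodCoeffAB Φ′ z u ≡ rightFactor z * Φ u
  prodCoeffAB-factorises u z deg-u |z|≡m = cdToAB-injective u λ x l →
    trans (cdToAB-prodCoeffAB≡abIndex⊗abIndex x z (trans l deg-u) |z|≡m)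
          (sym (trans (cdToAB-* (rightFactor z) Φ x) (cong (rightFactor z *_) (cdIndex x (trans l deg-u)))))

  Φ-cᵏ≡1 : Φ cᵏ ≡ + 1
  Φ-cᵏ≡1 = begin
      Φ cᵏ
    ≡⟨ cdToAB-cᵏ k Φ ⟨
      cdToAB Φ (replicate k false)
    ≡⟨ cdIndex (replicate k false) (Listₚ.length-replicate k) ⟩
      abIndex (flagFromℤ 1) (replicate k false)
    ≡⟨ abIndex-aᵏ k (flagFromℤ 1) ⟩
      + flag (replicate k false)
    ≡⟨ cong +_ (flagFrom-∅ k 1) ⟩
      + 1 ∎
    where open ≡-Reasoning

  prodCoeff-cᵏ-scaled : IsScaledCdIndexB m cb (prodCoeff Φ′ cᵏ)
  prodCoeff-cᵏ-scaled z |z|≡m =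
    trans (prodCoeffAB-factorises cᵏ z (deg-cᵏ k) |z|≡m)
          (trans (cong (rightFactor z *_) Φ-cᵏ≡1) (ℤₚ.*-identityʳ (rightFactor z)))

  -- Both sides, as cd-polynomials in w, have ab-expansion C(k+m+2, k+1) Φ(u) Ψ(B_(m+1)).
  prodCoeff-factorises : ∀ u w → deg u ≡ k → deg w ≡ m → prodCoeff Φ′ u w ≡ Φ u * prodCoeff Φ′ cᵏ w
  prodCoeff-factorises u w deg-u deg-w = cdToAB-injective w λ z l →
    trans (prodCoeffAB-factorises u z deg-u (trans l deg-w))
    (trans (ℤₚ.*-comm (rightFactor z) (Φ u))
           (sym (trans (cdToAB-* (Φ u) (prodCoeff Φ′ cᵏ) z) (cong (Φ u *_) (prodCoeff-cᵏ-scaled z (trans l deg-w))))))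

  prodCoeff-cᵏ-positive : ∀ w → deg w ≡ m → + 0 < prodCoeff Φ′ cᵏ w
  prodCoeff-cᵏ-positive = scaledCdIndex-positive m cb (prodCoeff Φ′ cᵏ) (binom[k+n,k]>0 (suc m) (suc k)) prodCoeff-cᵏ-scaled

comparison-by-positive-multiple : ∀ {K a b α β} → + 0 < K → α ≡ a * K → β ≡ b * K →
                                  ((b < a) ⇔ (β < α)) × ((a ≡ b) ⇔ (α ≡ β))
comparison-by-positive-multiple {K} {a} {b} K>0 refl refl =
  mk⇔ (ℤₚ.*-monoʳ-<-pos K {{ℤ.positive K>0}}) (ℤₚ.*-cancelʳ-<-nonNeg K {{ℤ.nonNegative (ℤₚ.<⇒≤ K>0)}}) ,
  mk⇔ (cong (_* K)) (ℤₚ.*-cancelʳ-≡ a b K {{ℤ.>-nonZero K>0}})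

lemma3p6 : (u v w : CDMono) → deg u ≡ deg v →
    (Φ : CDMono → ℤ) → IsCdIndexB (deg u) Φ →
    (Φ' : CDMono → ℤ) → IsCdIndexB (deg u ℕ.+ deg w ℕ.+ 1) Φ' →
    ((Φ v < Φ u) ⇔ (βlin Φ' (v · w) < βlin Φ' (u · w)))
    × ((Φ u ≡ Φ v) ⇔ (βlin Φ' (u · w) ≡ βlin Φ' (v · w)))
lemma3p6 u v w deg-u≡deg-v Φ isCd Φ′ isCd′ =
  comparison-by-positive-multiple (prodCoeff-cᵏ-positive w refl) (β-factorises u refl) (β-factorises v (sym deg-u≡deg-v))
  where
  open BooleanProduct (deg u) (deg w) Φ Φ′ isCd isCd′
  β-factorises : ∀ t → deg t ≡ deg u → βlin Φ′ (t · w) ≡ Φ t * prodCoeff Φ′ cᵏ w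
  β-factorises t deg-t = trans (βlin-· Φ′ t w) (prodCoeff-factorises t w deg-t refl)
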